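{- Let $K$ be a real quadratic field and $f$ a positive integer, with notation as below. The following are equivalent: (1) $\mathcal{U}_f$ contains a unit of norm $-1$; (2) $d_1-3$ is a perfect square, $j_{\min}(f)$ is odd, and the integer $\sqrt{\frac{d_{j_{\min}(f)}+1}{\Delta_0}}=\frac{f_{j_{\min}(f)}}{\sqrt{d_{j_{\min}(f)}-3}}$ is divisible by $f$. In that case, $\mathcal{U}_f=\{\pm u^{\,n\,j_{\min}(f)}: n\in\mathbb{Z}\}$.
   Context: Let $K\subset\mathbb{R}$ be a real quadratic field of discriminant $\Delta_0$; let $u$ be the smallest unit of $K$ greater than $1$ (the fundamental unit), and $\varepsilon$ the smallest unit of $K$ of norm $+1$ greater than $1$. For positive integers $j$ set $f_j=(\varepsilon^j-\varepsilon^{ -j})/\sqrt{\Delta_0}$ and $d_j=\varepsilon^j+\varepsilon^{ -j}+1$ (both integers). For a positive integer $f$, $\mathcal{O}_f=\{m+nf\frac{\Delta_0+\sqrt{\Delta_0}}{2}: m,n\in\mathbb{Z}\}$ is the order of conductor $f$, $\mathcal{U}_f=\mathcal{O}_f^\times$ is its unit group, and $j_{\min}(f)=\min\{j\ge1: f\mid f_j\}$ (this minimum exists). -}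

module Defs where

open import Data.Nat as ℕ using (ℕ; zero; suc)
open import Data.Nat.DivMod using (_/_; _%_)
open import Data.Nat.Divisibility as ℕD using ()
open import Data.Integer.Divisibility as ℤD using ()
open import Data.Integer as ℤ using (ℤ; +_; -_; _+_; _-_; _*_; _<_; _≤_; -1ℤ; 0ℤ; 1ℤ)
open import Data.Product using (_×_; _,_; Σ; ∃; ∃-syntax)
open import Data.Sum using (_⊎_)
open import Relation.Binary.PropositionalEquality using (_≡_)
open import Relation.Nullary using (¬_)

SquareFree : ℕ → Set
SquareFree m = ∀ p → (p ℕ.* p) ℕD.∣ m → p ≡ 1

RealQuadDisc : ℕ → Set
RealQuadDisc Δ = (1 ℕ.< Δ) ×
  ((Δ % 4 ≡ 1 × SquareFree Δ) ⊎
   (∃[ m ] (Δ ≡ 4 ℕ.* m × (m % 4 ≡ 2 ⊎ m % 4 ≡ 3) × SquareFree m)))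

-- Elements of O_K = ℤ[ω], ω = (Δ₀ + √Δ₀)/2.
-- The pair (x , y) stands for x + y ω.

Elt : Set
Elt = ℤ × ℤ

-- ω² = Δ₀ ω - c  with  c = (Δ₀² - Δ₀)/4  (an integer since Δ₀ ≡ 0,1 mod 4)
cω : ℕ → ℤ
cω Δ = + ((Δ ℕ.* Δ ℕ.∸ Δ) / 4)

module _ (Δ : ℕ) where

  one : Elt
  one = (1ℤ , 0ℤ)

  int : ℤ → Elt
  int n = (n , 0ℤ)

  _⊕_ : Elt → Elt → Elt
  (x₁ , y₁) ⊕ (x₂ , y₂) = (x₁ + x₂ , y₁ + y₂)

  _⊖_ : Elt → Elt → Elt
  (x₁ , y₁) ⊖ (x₂ , y₂) = (x₁ - x₂ , y₁ - y₂)

  neg : Elt → Elt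
  neg (x , y) = (- x , - y)

  _⊗_ : Elt → Elt → Elt
  (x₁ , y₁) ⊗ (x₂ , y₂) =
    (x₁ * x₂ - cω Δ * (y₁ * y₂) , x₁ * y₂ + x₂ * y₁ + + Δ * (y₁ * y₂))

  pow : Elt → ℕ → Elt
  pow z zero = one
  pow z (suc n) = z ⊗ pow z n

  -- n √Δ₀ = n (2ω - Δ₀)
  sqrtΔ* : ℤ → Elt
  sqrtΔ* n = (- (+ Δ * n) , + 2 * n)

  -- norm N(x + yω) = (x + yω)(x + yω')
  norm : Elt → ℤ
  norm (x , y) = x * x + + Δ * (x * y) + cω Δ * (y * y)

  InOrder : ℕ → Elt → Set
  InOrder f (x , y) = (+ f) ℤD.∣ y

  Unit : ℕ → Elt → Set
  Unit f z = InOrder f z × Σ Elt (λ w → InOrder f w × (z ⊗ w ≡ one))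

  -- real order.  Pos a b  means  a + b √Δ₀ > 0  (real number)
  Pos : ℤ → ℤ → Set
  Pos a b = (0ℤ < a × 0ℤ ≤ b)
          ⊎ (0ℤ ≤ a × 0ℤ < b)
          ⊎ (0ℤ < a × b < 0ℤ × + Δ * (b * b) < a * a)
          ⊎ (a < 0ℤ × 0ℤ < b × a * a < + Δ * (b * b))

  -- 2(x + yω) = (2x + Δ₀ y) + y √Δ₀
  IsPositive : Elt → Set
  IsPositive (x , y) = Pos (+ 2 * x + + Δ * y) y

  _≺_ : Elt → Elt → Set
  z ≺ w = IsPositive (w ⊖ z)

  _≼_ : Elt → Elt → Set
  z ≼ w = z ≺ w ⊎ z ≡ w

  IsFundUnit : Elt → Set
  IsFundUnit u = Unit 1 u × one ≺ u × (∀ v → Unit 1 v → one ≺ v → u ≼ v)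

  IsEps : Elt → Set
  IsEps e = Unit 1 e × norm e ≡ 1ℤ × one ≺ e
          × (∀ v → Unit 1 v → norm v ≡ 1ℤ → one ≺ v → e ≼ v)

  -- fF j = f_j = (ε^j - ε^{-j})/√Δ₀, characterised by
  --   (f_j √Δ₀) · ε^j = ε^{2j} - 1        (j ≥ 1)
  IsFSeq : Elt → (ℕ → ℤ) → Set
  IsFSeq e fF = ∀ j → 1 ℕ.≤ j →
    sqrtΔ* (fF j) ⊗ pow e j ≡ pow e (2 ℕ.* j) ⊖ one

  -- dF j = d_j = ε^j + ε^{-j} + 1, characterised by
  --   (d_j - 1) · ε^j = ε^{2j} + 1        (j ≥ 1)
  IsDSeq : Elt → (ℕ → ℤ) → Set
  IsDSeq e dF = ∀ j → 1 ℕ.≤ j →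
    int (dF j - 1ℤ) ⊗ pow e j ≡ pow e (2 ℕ.* j) ⊕ one

  -- v = ± u^{n j} for some n ∈ ℤ
  -- (n = k ≥ 0 : v = ±u^{kj};  n = -k : v · u^{kj} = ±1)
  PlusMinusPow : Elt → ℕ → Elt → Set
  PlusMinusPow u j v = ∃[ k ] ∃[ s ] ((s ≡ one ⊎ s ≡ neg one) ×
    (v ≡ s ⊗ pow u (k ℕ.* j) ⊎ v ⊗ pow u (k ℕ.* j) ≡ s))

IsJMin : (ℕ → ℤ) → ℕ → ℕ → Set
IsJMin fF f jm = 1 ℕ.≤ jm × (+ f) ℤD.∣ fF jm ×
  (∀ j → 1 ℕ.≤ j → (+ f) ℤD.∣ fF j → jm ℕ.≤ j)

Odd : ℕ → Set
Odd n = ∃[ k ] (n ≡ suc (2 ℕ.* k))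

IsSquare : ℤ → Set
IsSquare n = ∃[ s ] (s * s ≡ n)

-- A unit z = (A + B√Δ)/2 of O_K corresponds to a solution of A² - ΔB² = ±4, and z > 1
-- means A, B > 0.  Dividing a unit z > 1 by the fundamental unit u lowers A, so by descent
-- every unit is ±u^k or ±u^(-k).  A unit of norm -1 in O_f is then of this form with k odd,
-- which forces N u = -1 and hence ε = u², f_j = B(u^(2j)) and d_j - 1 = A(u^(2j)).
-- The exponents k with u^k ∈ O_f are closed under sums and differences, and since
-- 2 j_min(f) is one of them, they are multiples of j_min(f); an odd one makes j_min(f) odd
-- and u^j_min(f) ∈ O_f, whose coordinates give d₁ - 3 = A(u)² and Δ B(u^j_min)² = d_j_min + 1.
-- Conversely, if Δt² = d_j + 1 then N ε^j = 1 gives B(ε^j)² = (d_j - 3) t², so d_j - 3 = T²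
-- for an integer T, and (T + t√Δ)/2 is a unit of norm -1 lying in O_f when f ∣ t.

module Submission where

open import Defs
open import Algebra.Bundles using (AbelianGroup)
open import Data.Nat as ℕ using (ℕ; zero; suc; NonZero)
import Data.Nat.Properties as ℕP
open import Data.Nat.DivMod using (_/_; _%_; m≡m%n+[m/n]*n; m/n*n≡m; m%n<n)
open import Data.Nat.Divisibility as ℕD using (_∣_; divides)
open import Data.Nat.GCD using (gcd; gcd[m,n]∣m; gcd[m,n]∣n; gcd-greatest; gcd[m,n]≢0)
open import Data.Nat.Coprimality using (coprime-/gcd; coprime-divisor; coprime⇒gcd≡1)
open import Data.Nat.Primality using (euclidsLemma; prime[2])
import Data.Nat.Tactic.RingSolver as ℕSolver
open import Data.Integer as ℤ using (ℤ; +_; -_; _+_; _-_; _*_; -1ℤ; 0ℤ; 1ℤ; _<_; _≤_; +≤+; +<+; -<+; -≤+; -[1+_])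
import Data.Integer.Properties as ℤP
import Data.Integer.Divisibility as ℤD
import Data.Integer.Divisibility.Signed as ℤS
open import Data.Integer.Tactic.RingSolver using (solve-∀)
open import Algebra.Properties.Group (AbelianGroup.group ℤP.+-0-abelianGroup) using (∙-cancelʳ)
open import Data.Product using (_×_; _,_; Σ; ∃-syntax; proj₁; proj₂)
open import Data.Sum using (_⊎_; inj₁; inj₂; reduce)
open import Data.Empty using (⊥; ⊥-elim)
open import Function.Bundles using (_⇔_; mk⇔)
open import Relation.Nullary using (¬_; yes; no)
open import Relation.Binary.Definitions using (tri<; tri≈; tri>)
open import Relation.Binary.PropositionalEquality
  using (_≡_; _≢_; refl; sym; trans; cong; cong₂; subst; subst₂; module ≡-Reasoning)

-- A ring identity that holds once the hypothesis X ≡ Y is used; this is how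
-- identities that are polynomial only modulo some equation are verified.
ring-mod : ∀ {L R X Y : ℤ} → X ≡ Y → L ≡ R + (X - Y) → L ≡ R
ring-mod {R = R} {X} refl p = trans p (cancel R X)
  where
  cancel : ∀ R X → R + (X - X) ≡ R
  cancel = solve-∀

0≤+ : ∀ n → 0ℤ ≤ + n
0≤+ n = +≤+ ℕ.z≤n

+-nonNeg : ∀ {a b} → 0ℤ ≤ a → 0ℤ ≤ b → 0ℤ ≤ a + b
+-nonNeg = ℤP.+-mono-≤

*-nonNeg : ∀ {a b} → 0ℤ ≤ a → 0ℤ ≤ b → 0ℤ ≤ a * b
*-nonNeg {+ m} {+ n} _ _ = subst (0ℤ ≤_) (ℤP.pos-* m n) (0≤+ (m ℕ.* n))

square-nonNeg : ∀ a → 0ℤ ≤ a * a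
square-nonNeg (+ n) = *-nonNeg (0≤+ n) (0≤+ n)
square-nonNeg -[1+ n ] = 0≤+ _

i<j⇒0≤j-i-1 : ∀ {i j} → i < j → 0ℤ ≤ j - i - 1ℤ
i<j⇒0≤j-i-1 {i} {j} i<j =
  subst (0ℤ ≤_) (shift i j) (ℤP.i≤j⇒0≤j-i (ℤP.i<j⇒suc[i]≤j i<j))
  where
  shift : ∀ i j → j - (1ℤ + i) ≡ j - i - 1ℤ
  shift = solve-∀

0<i⇒0≤i-1 : ∀ {i} → 0ℤ < i → 0ℤ ≤ i - 1ℤ
0<i⇒0≤i-1 {i} 0<i = subst (0ℤ ≤_) (shift i) (i<j⇒0≤j-i-1 0<i)
  where
  shift : ∀ i → i - 0ℤ - 1ℤ ≡ i - 1ℤ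
  shift = solve-∀

-- Strict and weak inequalities are established by exhibiting the difference
-- as (1 +) a term that is visibly nonnegative.
0<-witness : ∀ {x} r → 0ℤ ≤ r → x ≡ 1ℤ + r → 0ℤ < x
0<-witness r 0≤r refl = ℤP.suc[i]≤j⇒i<j (ℤP.+-monoʳ-≤ 1ℤ 0≤r)

0<j-i⇒i<j : ∀ {i j} → 0ℤ < j - i → i < j
0<j-i⇒i<j {i} {j} h = subst₂ _<_ (ℤP.+-identityˡ i) (cancel i j) (ℤP.+-monoˡ-< i h)
  where
  cancel : ∀ i j → j - i + i ≡ j
  cancel = solve-∀

<-witness : ∀ {x y} r → 0ℤ ≤ r → y - x ≡ 1ℤ + r → x < y
<-witness r 0≤r eq = 0<j-i⇒i<j (0<-witness r 0≤r eq)

≤-witness : ∀ {x y} r → 0ℤ ≤ r → y - x ≡ r → x ≤ y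
≤-witness r 0≤r eq = ℤP.0≤i-j⇒j≤i (subst (0ℤ ≤_) (sym eq) 0≤r)

1+nonNeg≢0 : ∀ r → 0ℤ ≤ r → 1ℤ + r ≢ 0ℤ
1+nonNeg≢0 r 0≤r eq = ℤP.<-irrefl (sym eq) (0<-witness r 0≤r refl)

<⇒square-< : ∀ {x y} → 0ℤ < x → x < y → x * x < y * y
<⇒square-< {x} {y} 0<x x<y = <-witness _ 0≤r (expand x y)
  where
  k = i<j⇒0≤j-i-1 x<y
  x≥0 = ℤP.<⇒≤ 0<x
  0≤r = +-nonNeg (+-nonNeg (+-nonNeg (*-nonNeg (0≤+ 2) x≥0) (*-nonNeg (*-nonNeg (0≤+ 2) x≥0) k))
          (*-nonNeg (0≤+ 2) k)) (*-nonNeg k k)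
  expand : ∀ x y → y * y - x * x ≡ 1ℤ + (+ 2 * x + + 2 * x * (y - x - 1ℤ) + + 2 * (y - x - 1ℤ)
                                        + (y - x - 1ℤ) * (y - x - 1ℤ))
  expand = solve-∀

square-<⇒< : ∀ {x y} → 0ℤ < x → y * y < x * x → y < x
square-<⇒< {x} {y} 0<x y²<x² with ℤP.<-cmp y x
... | tri< y<x _ _ = y<x
... | tri≈ _ refl _ = ⊥-elim (ℤP.<-irrefl refl y²<x²)
... | tri> _ _ x<y = ⊥-elim (ℤP.<-asym y²<x² (<⇒square-< 0<x x<y))

i<j⇒0<j-i : ∀ {i j} → i < j → 0ℤ < j - i
i<j⇒0<j-i {i} {j} i<j = subst (_< j - i) (ℤP.+-inverseʳ i) (ℤP.+-monoˡ-< (- i) i<j)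

*-pos : ∀ {x y} → 0ℤ < x → 0ℤ < y → 0ℤ < x * y
*-pos {x} {y} 0<x 0<y = 0<-witness _ (+-nonNeg (*-nonNeg (0<i⇒0≤i-1 0<x) (ℤP.<⇒≤ 0<y)) (0<i⇒0≤i-1 0<y)) (expand x y)
  where
  expand : ∀ x y → x * y ≡ 1ℤ + ((x - 1ℤ) * y + (y - 1ℤ))
  expand = solve-∀

<-by-squares : ∀ {x y} g → 0ℤ < y → y * y - x * x ≡ g → 0ℤ < g → x < y
<-by-squares g 0<y eq 0<g = square-<⇒< 0<y (0<j-i⇒i<j (subst (0ℤ <_) (sym eq) 0<g))

squares-swap : ∀ x y {g} → x * x - y * y ≡ g → y * y - x * x ≡ - g
squares-swap x y eq = trans (swap x y) (cong -_ eq)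
  where
  swap : ∀ x y → y * y - x * x ≡ - (x * x - y * y)
  swap = solve-∀

0<b<B⇒0<4B²-4b² : ∀ {b B} → 0ℤ < b → b < B → 0ℤ < + 4 * (B * B) - + 4 * (b * b)
0<b<B⇒0<4B²-4b² {b} {B} 0<b b<B = 0<-witness _ 0≤r (expand b B)
  where
  k = i<j⇒0≤j-i-1 b<B
  b≥0 = ℤP.<⇒≤ 0<b
  0≤r = +-nonNeg (+-nonNeg (+-nonNeg (+-nonNeg (0≤+ 3) (*-nonNeg (0≤+ 8) b≥0)) (*-nonNeg (0≤+ 8) k))
          (*-nonNeg (*-nonNeg (0≤+ 8) b≥0) k)) (*-nonNeg (*-nonNeg (0≤+ 4) k) k)
  expand : ∀ b B → + 4 * (B * B) - + 4 * (b * b)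
    ≡ 1ℤ + (+ 3 + + 8 * b + + 8 * (B - b - 1ℤ) + + 8 * b * (B - b - 1ℤ) + + 4 * (B - b - 1ℤ) * (B - b - 1ℤ))
  expand = solve-∀

i<j⇒i-j<0 : ∀ {i j} → i < j → i - j < 0ℤ
i<j⇒i-j<0 {i} {j} i<j = subst (i - j <_) (ℤP.+-inverseʳ j) (ℤP.+-monoˡ-< (- j) i<j)

+∣i∣*+∣i∣≡i*i : ∀ i → + ℤ.∣ i ∣ * + ℤ.∣ i ∣ ≡ i * i
+∣i∣*+∣i∣≡i*i i = trans (sym (ℤP.pos-* ℤ.∣ i ∣ ℤ.∣ i ∣))
                   (trans (cong +_ (sym (ℤP.abs-* i i))) (ℤP.0≤i⇒+∣i∣≡i (square-nonNeg i)))

IsSign : ℤ → Set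
IsSign s = s ≡ 1ℤ ⊎ s ≡ -1ℤ

sign⇒0≤1-s : ∀ {s} → IsSign s → 0ℤ ≤ 1ℤ - s
sign⇒0≤1-s (inj₁ refl) = 0≤+ 0
sign⇒0≤1-s (inj₂ refl) = 0≤+ 2

sign⇒0≤1+s : ∀ {s} → IsSign s → 0ℤ ≤ 1ℤ + s
sign⇒0≤1+s (inj₁ refl) = 0≤+ 2
sign⇒0≤1+s (inj₂ refl) = 0≤+ 0

sign-* : ∀ {s t} → IsSign s → IsSign t → IsSign (s * t)
sign-* (inj₁ refl) (inj₁ refl) = inj₁ refl
sign-* (inj₁ refl) (inj₂ refl) = inj₂ refl
sign-* (inj₂ refl) (inj₁ refl) = inj₂ refl
sign-* (inj₂ refl) (inj₂ refl) = inj₁ refl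

sign-square : ∀ {s} → IsSign s → s * s ≡ 1ℤ
sign-square (inj₁ refl) = refl
sign-square (inj₂ refl) = refl

*≡1⇒sign : ∀ {a b} → a * b ≡ 1ℤ → IsSign a
*≡1⇒sign {a} {b} ab≡1 =
  ∣a∣≡1⇒sign a (ℕP.m*n≡1⇒m≡1 ℤ.∣ a ∣ ℤ.∣ b ∣ (trans (sym (ℤP.abs-* a b)) (cong ℤ.∣_∣ ab≡1)))
  where
  ∣a∣≡1⇒sign : ∀ a → ℤ.∣ a ∣ ≡ 1 → IsSign a
  ∣a∣≡1⇒sign (+ 1) _ = inj₁ refl
  ∣a∣≡1⇒sign -[1+ 0 ] _ = inj₂ refl
  ∣a∣≡1⇒sign (+ 0) ()
  ∣a∣≡1⇒sign (+ suc (suc n)) ()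
  ∣a∣≡1⇒sign -[1+ suc n ] ()

Even : ℕ → Set
Even n = ∃[ k ] (n ≡ 2 ℕ.* k)

parity : ∀ n → Even n ⊎ Odd n
parity zero = inj₁ (0 , refl)
parity (suc n) with parity n
... | inj₁ (k , refl) = inj₂ (k , refl)
... | inj₂ (k , refl) = inj₁ (suc k , cong suc (sym (ℕP.+-suc k (k ℕ.+ 0))))

odd⇒¬even : ∀ {n} → Odd n → Even n → ⊥
odd⇒¬even (a , refl) (b , eq) = ℕP.even≢odd b a (sym eq)

even-*ˡ : ∀ {m} n → Even m → Even (m ℕ.* n)
even-*ˡ n (k , refl) = k ℕ.* n , ℕP.*-assoc 2 k n

even-*ʳ : ∀ m {n} → Even n → Even (m ℕ.* n)
even-*ʳ m {n} ev = subst Even (ℕP.*-comm n m) (even-*ˡ m ev)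

-1^even : ∀ {n} → Even n → -1ℤ ℤ.^ n ≡ 1ℤ
-1^even (k , refl) = trans (sym (ℤP.^-*-assoc -1ℤ 2 k)) (ℤP.^-zeroˡ k)

-1^odd : ∀ {n} → Odd n → -1ℤ ℤ.^ n ≡ -1ℤ
-1^odd (k , refl) = cong (-1ℤ *_) (-1^even (k , refl))

sign^n≡-1 : ∀ {s} n → IsSign s → s ℤ.^ n ≡ -1ℤ → s ≡ -1ℤ × Odd n
sign^n≡-1 n (inj₁ refl) 1^n≡-1 with () ← trans (sym (ℤP.^-zeroˡ n)) 1^n≡-1
sign^n≡-1 n (inj₂ refl) -1^n≡-1 with parity n
... | inj₂ odd = refl , odd
... | inj₁ ev with () ← trans (sym (-1^even ev)) -1^n≡-1

2∣m*m⇒2∣m : ∀ m → 2 ∣ m ℕ.* m → 2 ∣ m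
2∣m*m⇒2∣m m 2∣m² = reduce (euclidsLemma m m prime[2] 2∣m²)

-- In lowest terms m/g and n/g are coprime, so m/g ∣ (n/g)² forces m/g = 1.
m*m∣n*n⇒m∣n : ∀ m n → .{{NonZero m}} → m ℕ.* m ∣ n ℕ.* n → m ∣ n
m*m∣n*n⇒m∣n m n m²∣n² = subst (_∣ n) (sym m≡g) (gcd[m,n]∣n m n)
  where
  g = gcd m n
  instance
    g≢0 : NonZero g
    g≢0 = ℕ.≢-nonZero (gcd[m,n]≢0 m n (inj₁ (ℕ.≢-nonZero⁻¹ m)))
    g²≢0 : NonZero (g ℕ.* g)
    g²≢0 = ℕP.m*n≢0 g g
  m′ = m / g
  n′ = n / g
  square-scale : ∀ a g → a ℕ.* g ℕ.* (a ℕ.* g) ≡ a ℕ.* a ℕ.* (g ℕ.* g)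
  square-scale = ℕSolver.solve-∀
  rescale : ∀ {a} → g ∣ a → a ℕ.* a ≡ a / g ℕ.* (a / g) ℕ.* (g ℕ.* g)
  rescale {a} g∣a = trans (cong₂ ℕ._*_ (sym (m/n*n≡m g∣a)) (sym (m/n*n≡m g∣a))) (square-scale (a / g) g)
  m′∣n′² : m′ ∣ n′ ℕ.* n′
  m′∣n′² = ℕD.∣-trans (ℕD.m∣m*n m′)
             (ℕD.*-cancelʳ-∣ (g ℕ.* g) (subst₂ _∣_ (rescale (gcd[m,n]∣m m n)) (rescale (gcd[m,n]∣n m n)) m²∣n²))
  m′≡1 : m′ ≡ 1
  m′≡1 = ℕD.∣1⇒≡1 (subst (m′ ∣_) (coprime⇒gcd≡1 (coprime-/gcd m n))
           (gcd-greatest ℕD.∣-refl (coprime-divisor (coprime-/gcd m n) m′∣n′²)))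
  m≡g : m ≡ g
  m≡g = trans (sym (m/n*n≡m (gcd[m,n]∣m m n))) (trans (cong (ℕ._* g) m′≡1) (ℕP.*-identityˡ g))

square-ratio⇒square : ∀ F D t .{{_ : NonZero t}} → F * F ≡ D * (+ t * + t) → Σ ℤ λ T → T * T ≡ D
square-ratio⇒square F D t F²≡Dt² =
  T , ℤP.*-cancelʳ-≡ (T * T) D (+ t * + t) (trans (regroup T (+ t)) (trans (cong (λ y → y * y) (sym F≡Tt)) F²≡Dt²))
  where
  instance
    t²≢0 : ℤ.NonZero (+ t * + t)
    t²≢0 = ℤP.i*j≢0 (+ t) (+ t)
  t∣F : + t ℤS.∣ F
  t∣F = ℤS.∣ᵤ⇒∣ {+ t} {F} (m*m∣n*n⇒m∣n t ℤ.∣ F ∣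
          (subst₂ _∣_ (ℤP.abs-* (+ t) (+ t)) (ℤP.abs-* F F) (ℤS.∣⇒∣ᵤ {+ t * + t} {F * F} (ℤS.divides D F²≡Dt²))))
  T = ℤS._∣_.quotient t∣F
  F≡Tt : F ≡ T * + t
  F≡Tt = ℤS._∣_.equality t∣F
  regroup : ∀ T t → T * T * (t * t) ≡ (T * t) * (T * t)
  regroup = solve-∀

RealQuadDisc⇒5≤Δ : ∀ {Δ} → RealQuadDisc Δ → 5 ℕ.≤ Δ
RealQuadDisc⇒5≤Δ {Δ} (1<Δ , inj₁ (Δ%4≡1 , _)) = odd-case Δ 1<Δ Δ%4≡1
  where
  odd-case : ∀ Δ → 1 ℕ.< Δ → Δ % 4 ≡ 1 → 5 ℕ.≤ Δ
  odd-case (suc (suc (suc (suc (suc _))))) _ _ = ℕ.s≤s (ℕ.s≤s (ℕ.s≤s (ℕ.s≤s (ℕ.s≤s ℕ.z≤n))))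
  odd-case 1 (ℕ.s≤s ()) _
  odd-case 2 _ ()
  odd-case 3 _ ()
  odd-case 4 _ ()
RealQuadDisc⇒5≤Δ (_ , inj₂ (m , refl , m%4 , _)) = ℕP.≤-trans (ℕP.m≤n+m 5 3) (ℕP.*-monoʳ-≤ 4 (2≤m m m%4))
  where
  2≤m : ∀ m → (m % 4 ≡ 2 ⊎ m % 4 ≡ 3) → 2 ℕ.≤ m
  2≤m (suc (suc _)) _ = ℕ.s≤s (ℕ.s≤s ℕ.z≤n)
  2≤m 0 (inj₁ ())
  2≤m 0 (inj₂ ())
  2≤m 1 (inj₁ ())
  2≤m 1 (inj₂ ())

4∣Δ²-Δ : ∀ {Δ} → RealQuadDisc Δ → 4 ∣ Δ ℕ.* Δ ℕ.∸ Δ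
4∣Δ²-Δ {Δ} disc = subst (4 ∣_) Δ[Δ-1]≡Δ²-Δ (4∣Δ[Δ-1] disc)
  where
  Δ[Δ-1]≡Δ²-Δ : Δ ℕ.* (Δ ℕ.∸ 1) ≡ Δ ℕ.* Δ ℕ.∸ Δ
  Δ[Δ-1]≡Δ²-Δ = trans (ℕP.*-distribˡ-∸ Δ Δ 1) (cong (Δ ℕ.* Δ ℕ.∸_) (ℕP.*-identityʳ Δ))
  4∣Δ[Δ-1] : RealQuadDisc Δ → 4 ∣ Δ ℕ.* (Δ ℕ.∸ 1)
  4∣Δ[Δ-1] (_ , inj₁ (Δ%4≡1 , _)) = ℕD.∣n⇒∣m*n Δ (divides (Δ / 4) Δ-1≡q*4)
    where
    Δ-1≡q*4 : Δ ℕ.∸ 1 ≡ Δ / 4 ℕ.* 4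
    Δ-1≡q*4 = cong (ℕ._∸ 1) (trans (m≡m%n+[m/n]*n Δ 4) (cong (ℕ._+ Δ / 4 ℕ.* 4) Δ%4≡1))
  4∣Δ[Δ-1] (_ , inj₂ (m , Δ≡4m , _)) = ℕD.∣m⇒∣m*n (Δ ℕ.∸ 1) (divides m (trans Δ≡4m (ℕP.*-comm 4 m)))

-- The division defining cω is exact, so ω = (Δ + √Δ)/2 satisfies ω² = Δω - cω.
4cω≡Δ²-Δ : ∀ {Δ} → RealQuadDisc Δ → + 4 * cω Δ ≡ + Δ * + Δ - + Δ
4cω≡Δ²-Δ {Δ} disc = begin
  + 4 * + ((Δ ℕ.* Δ ℕ.∸ Δ) / 4)   ≡⟨ sym (ℤP.pos-* 4 ((Δ ℕ.* Δ ℕ.∸ Δ) / 4)) ⟩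
  + (4 ℕ.* ((Δ ℕ.* Δ ℕ.∸ Δ) / 4)) ≡⟨ cong +_ (trans (ℕP.*-comm 4 ((Δ ℕ.* Δ ℕ.∸ Δ) / 4))
                                                     (m/n*n≡m (4∣Δ²-Δ disc))) ⟩
  + (Δ ℕ.* Δ ℕ.∸ Δ)               ≡⟨ sym (ℤP.≤-⊖ Δ≤Δ²) ⟩
  (Δ ℕ.* Δ) ℤ.⊖ Δ                 ≡⟨ sym (ℤP.m-n≡m⊖n (Δ ℕ.* Δ) Δ) ⟩
  + (Δ ℕ.* Δ) - + Δ               ≡⟨ cong (_- + Δ) (ℤP.pos-* Δ Δ) ⟩
  + Δ * + Δ - + Δ                 ∎
  where
  open ≡-Reasoning
  Δ≤Δ² : Δ ℕ.≤ Δ ℕ.* Δ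
  Δ≤Δ² = ℕP.m≤m*n Δ Δ {{ℕ.>-nonZero (ℕP.<-trans (ℕ.s≤s ℕ.z≤n) (proj₁ disc))}}

-- For a set P of exponents closed under sums and differences and j₀ minimal with
-- 2 j₀ ∈ P, every k ∈ P is a multiple of j₀: reduce 2k modulo 2 j₀.
module ExponentSet (P : ℕ → Set)
                   (P-+ : ∀ {m n} → P m → P n → P (m ℕ.+ n))
                   (P-∸ : ∀ {m n} → P (m ℕ.+ n) → P n → P m) where

  P-* : ∀ q {m} → P m → P (q ℕ.* m)
  P-* zero {m} Pm = P-∸ {0} {m} Pm Pm
  P-* (suc q) Pm = P-+ Pm (P-* q Pm)

  module _ {j₀ : ℕ} .{{_ : NonZero j₀}} (P[j₀*2] : P (j₀ ℕ.* 2))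
           (j₀-minimal : ∀ j → 1 ℕ.≤ j → P (j ℕ.* 2) → j₀ ℕ.≤ j) where

    j₀∣ : ∀ {k} → P k → j₀ ∣ k
    j₀∣ {k} Pk = by-remainder (k % j₀) (m≡m%n+[m/n]*n k j₀) (m%n<n k j₀)
      where
      double : ∀ r q j → (r ℕ.+ q ℕ.* j) ℕ.+ (r ℕ.+ q ℕ.* j) ≡ r ℕ.* 2 ℕ.+ q ℕ.* (j ℕ.* 2)
      double = ℕSolver.solve-∀
      by-remainder : ∀ r → k ≡ r ℕ.+ k / j₀ ℕ.* j₀ → r ℕ.< j₀ → j₀ ∣ k
      by-remainder zero k≡q*j₀ _ = divides (k / j₀) k≡q*j₀
      by-remainder (suc r) k≡r+q*j₀ r<j₀ = ⊥-elim (ℕP.<⇒≱ r<j₀ (j₀-minimal (suc r) (ℕ.s≤s ℕ.z≤n) P[r*2]))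
        where
        P[r*2] : P (suc r ℕ.* 2)
        P[r*2] = P-∸ (subst P (trans (cong (λ n → n ℕ.+ n) k≡r+q*j₀) (double (suc r) (k / j₀) j₀)) (P-+ Pk Pk))
                     (P-* (k / j₀) P[j₀*2])

    odd⇒j₀-odd : ∀ {k} → P k → Odd k → Odd j₀ × P j₀
    odd⇒j₀-odd {k} Pk odd-k with j₀∣ Pk
    ... | divides q refl with parity j₀ | parity q
    ... | inj₁ even-j₀ | _ = ⊥-elim (odd⇒¬even odd-k (even-*ʳ q even-j₀))
    ... | inj₂ _ | inj₁ even-q = ⊥-elim (odd⇒¬even odd-k (even-*ˡ j₀ even-q))
    ... | inj₂ odd-j₀ | inj₂ (e , refl) = odd-j₀ , P-∸ (subst P (expand e j₀) Pk) (P-* e P[j₀*2])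
      where
      expand : ∀ e j₀ → suc (2 ℕ.* e) ℕ.* j₀ ≡ j₀ ℕ.+ e ℕ.* (j₀ ℕ.* 2)
      expand = ℕSolver.solve-∀


module QuadraticRing (Δ : ℕ) where

  d : ℤ
  d = + Δ

  c : ℤ
  c = cω Δ

  infixl 7 _·_
  _·_ : Elt → Elt → Elt
  _·_ = _⊗_ Δ

  infixr 8 _^_
  _^_ : Elt → ℕ → Elt
  _^_ = pow Δ

  𝟙 : Elt
  𝟙 = one Δ

  [_] : ℤ → Elt
  [_] = int Δ

  negate : Elt → Elt
  negate = neg Δ

  N : Elt → ℤ
  N = norm Δ

  conj : Elt → Elt
  conj (x , y) = (x + d * y , - y)

  -- z = (tr z + im z √Δ) / 2
  tr : Elt → ℤ
  tr (x , y) = + 2 * x + d * y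

  im : Elt → ℤ
  im (x , y) = y

  ·-comm : ∀ z w → z · w ≡ w · z
  ·-comm (x₁ , y₁) (x₂ , y₂) = cong₂ _,_ (real x₁ y₁ x₂ y₂ c) (irrational x₁ y₁ x₂ y₂ d)
    where
    real : ∀ x₁ y₁ x₂ y₂ c → x₁ * x₂ - c * (y₁ * y₂) ≡ x₂ * x₁ - c * (y₂ * y₁)
    real = solve-∀
    irrational : ∀ x₁ y₁ x₂ y₂ d → x₁ * y₂ + x₂ * y₁ + d * (y₁ * y₂) ≡ x₂ * y₁ + x₁ * y₂ + d * (y₂ * y₁)
    irrational = solve-∀

  ·-assoc : ∀ z w v → (z · w) · v ≡ z · (w · v)
  ·-assoc (x₁ , y₁) (x₂ , y₂) (x₃ , y₃) =
    cong₂ _,_ (real c d x₁ y₁ x₂ y₂ x₃ y₃) (irrational c d x₁ y₁ x₂ y₂ x₃ y₃)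
    where
    real : ∀ c d x₁ y₁ x₂ y₂ x₃ y₃ →
      (x₁ * x₂ - c * (y₁ * y₂)) * x₃ - c * ((x₁ * y₂ + x₂ * y₁ + d * (y₁ * y₂)) * y₃)
      ≡ x₁ * (x₂ * x₃ - c * (y₂ * y₃)) - c * (y₁ * (x₂ * y₃ + x₃ * y₂ + d * (y₂ * y₃)))
    real = solve-∀
    irrational : ∀ c d x₁ y₁ x₂ y₂ x₃ y₃ →
      (x₁ * x₂ - c * (y₁ * y₂)) * y₃ + x₃ * (x₁ * y₂ + x₂ * y₁ + d * (y₁ * y₂))
        + d * ((x₁ * y₂ + x₂ * y₁ + d * (y₁ * y₂)) * y₃)
      ≡ x₁ * (x₂ * y₃ + x₃ * y₂ + d * (y₂ * y₃)) + (x₂ * x₃ - c * (y₂ * y₃)) * y₁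
        + d * (y₁ * (x₂ * y₃ + x₃ * y₂ + d * (y₂ * y₃)))
    irrational = solve-∀

  ·-identityˡ : ∀ z → 𝟙 · z ≡ z
  ·-identityˡ (x , y) = cong₂ _,_ (real c x y) (irrational d x y)
    where
    real : ∀ c x y → 1ℤ * x - c * (0ℤ * y) ≡ x
    real = solve-∀
    irrational : ∀ d x y → 1ℤ * y + x * 0ℤ + d * (0ℤ * y) ≡ y
    irrational = solve-∀

  ·-identityʳ : ∀ z → z · 𝟙 ≡ z
  ·-identityʳ z = trans (·-comm z 𝟙) (·-identityˡ z)

  negate-·ˡ : ∀ z w → negate z · w ≡ negate (z · w)
  negate-·ˡ (x₁ , y₁) (x₂ , y₂) = cong₂ _,_ (real c x₁ y₁ x₂ y₂) (irrational d x₁ y₁ x₂ y₂)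
    where
    real : ∀ c x₁ y₁ x₂ y₂ → (- x₁) * x₂ - c * ((- y₁) * y₂) ≡ - (x₁ * x₂ - c * (y₁ * y₂))
    real = solve-∀
    irrational : ∀ d x₁ y₁ x₂ y₂ →
      (- x₁) * y₂ + x₂ * (- y₁) + d * ((- y₁) * y₂) ≡ - (x₁ * y₂ + x₂ * y₁ + d * (y₁ * y₂))
    irrational = solve-∀

  negate-involutive : ∀ z → negate (negate z) ≡ z
  negate-involutive (x , y) = cong₂ _,_ (ℤP.neg-involutive x) (ℤP.neg-involutive y)

  ·-negate𝟙 : ∀ z → z · negate 𝟙 ≡ negate z
  ·-negate𝟙 z = trans (·-comm z (negate 𝟙)) (trans (negate-·ˡ 𝟙 z) (cong negate (·-identityˡ z)))

  [n]·[n] : ∀ n → [ n ] · [ n ] ≡ [ n * n ]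
  [n]·[n] n = cong₂ _,_ (real c n) (irrational d n)
    where
    real : ∀ c n → n * n - c * (0ℤ * 0ℤ) ≡ n * n
    real = solve-∀
    irrational : ∀ d n → n * 0ℤ + n * 0ℤ + d * (0ℤ * 0ℤ) ≡ 0ℤ
    irrational = solve-∀

  ·-conj : ∀ z → z · conj z ≡ [ N z ]
  ·-conj (x , y) = cong₂ _,_ (real c d x y) (irrational c d x y)
    where
    real : ∀ c d x y → x * (x + d * y) - c * (y * (- y)) ≡ x * x + d * (x * y) + c * (y * y)
    real = solve-∀
    irrational : ∀ c d x y → x * (- y) + (x + d * y) * y + d * (y * (- y)) ≡ 0ℤ
    irrational = solve-∀

  ·conj·≡·[N] : ∀ z w → z · conj w · w ≡ z · [ N w ]
  ·conj·≡·[N] z w = trans (·-assoc z (conj w) w) (cong (z ·_) (trans (·-comm (conj w) w) (·-conj w)))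

  norm-· : ∀ z w → N (z · w) ≡ N z * N w
  norm-· (x₁ , y₁) (x₂ , y₂) = identity c d x₁ y₁ x₂ y₂
    where
    identity : ∀ c d x₁ y₁ x₂ y₂ →
      (x₁ * x₂ - c * (y₁ * y₂)) * (x₁ * x₂ - c * (y₁ * y₂))
        + d * ((x₁ * x₂ - c * (y₁ * y₂)) * (x₁ * y₂ + x₂ * y₁ + d * (y₁ * y₂)))
        + c * ((x₁ * y₂ + x₂ * y₁ + d * (y₁ * y₂)) * (x₁ * y₂ + x₂ * y₁ + d * (y₁ * y₂)))
      ≡ (x₁ * x₁ + d * (x₁ * y₁) + c * (y₁ * y₁)) * (x₂ * x₂ + d * (x₂ * y₂) + c * (y₂ * y₂))
    identity = solve-∀

  norm-negate : ∀ z → N (negate z) ≡ N z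
  norm-negate (x , y) = identity c d x y
    where
    identity : ∀ c d x y →
      (- x) * (- x) + d * ((- x) * (- y)) + c * ((- y) * (- y)) ≡ x * x + d * (x * y) + c * (y * y)
    identity = solve-∀

  norm-conj : ∀ z → N (conj z) ≡ N z
  norm-conj (x , y) = identity c d x y
    where
    identity : ∀ c d x y →
      (x + d * y) * (x + d * y) + d * ((x + d * y) * (- y)) + c * ((- y) * (- y))
      ≡ x * x + d * (x * y) + c * (y * y)
    identity = solve-∀

  norm-𝟙 : N 𝟙 ≡ 1ℤ
  norm-𝟙 = identity c d
    where
    identity : ∀ c d → 1ℤ * 1ℤ + d * (1ℤ * 0ℤ) + c * (0ℤ * 0ℤ) ≡ 1ℤ
    identity = solve-∀

  norm-^ : ∀ z n → N (z ^ n) ≡ N z ℤ.^ n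
  norm-^ z zero = norm-𝟙
  norm-^ z (suc n) = trans (norm-· z (z ^ n)) (cong (N z *_) (norm-^ z n))

  ^-+ : ∀ z m n → z ^ (m ℕ.+ n) ≡ z ^ m · z ^ n
  ^-+ z zero n = sym (·-identityˡ (z ^ n))
  ^-+ z (suc m) n = trans (cong (z ·_) (^-+ z m n)) (sym (·-assoc z (z ^ m) (z ^ n)))

  ^-* : ∀ z m n → z ^ (m ℕ.* n) ≡ (z ^ n) ^ m
  ^-* z zero n = refl
  ^-* z (suc m) n = trans (^-+ z n (m ℕ.* n)) (cong (z ^ n ·_) (^-* z m n))

  ^-double : ∀ z j → z ^ (2 ℕ.* j) ≡ z ^ j · z ^ j
  ^-double z j = trans (^-+ z j (j ℕ.+ 0)) (cong (λ k → z ^ j · z ^ k) (ℕP.+-identityʳ j))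

  im-· : ∀ z w → + 2 * im (z · w) ≡ tr z * im w + tr w * im z
  im-· (x₁ , y₁) (x₂ , y₂) = identity d x₁ y₁ x₂ y₂
    where
    identity : ∀ d x₁ y₁ x₂ y₂ →
      + 2 * (x₁ * y₂ + x₂ * y₁ + d * (y₁ * y₂)) ≡ (+ 2 * x₁ + d * y₁) * y₂ + (+ 2 * x₂ + d * y₂) * y₁
    identity = solve-∀

  tr-conj : ∀ z → tr (conj z) ≡ tr z
  tr-conj (x , y) = identity d x y
    where
    identity : ∀ d x y → + 2 * (x + d * y) + d * (- y) ≡ + 2 * x + d * y
    identity = solve-∀

  tr-negate : ∀ z → tr (negate z) ≡ - tr z
  tr-negate (x , y) = identity d x y
    where
    identity : ∀ d x y → + 2 * (- x) + d * (- y) ≡ - (+ 2 * x + d * y)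
    identity = solve-∀

  im-·conj : ∀ z w → + 2 * im (z · conj w) ≡ tr w * im z - tr z * im w
  im-·conj z w = trans (im-· z (conj w))
    (trans (cong (λ t → tr z * - im w + t * im z) (tr-conj w)) (expand (tr z) (im z) (tr w) (im w)))
    where
    expand : ∀ A B a b → A * - b + a * B ≡ a * B - A * b
    expand = solve-∀

  tr-𝟙 : tr 𝟙 ≡ + 2
  tr-𝟙 = identity d
    where
    identity : ∀ d → + 2 * 1ℤ + d * 0ℤ ≡ + 2
    identity = solve-∀

  tr-im-injective : ∀ z w → tr z ≡ tr w → im z ≡ im w → z ≡ w
  tr-im-injective (x₁ , y) (x₂ , .y) tr≡ refl =
    cong₂ _,_ (ℤP.*-cancelˡ-≡ (+ 2) x₁ x₂ (∙-cancelʳ (d * y) (+ 2 * x₁) (+ 2 * x₂) tr≡)) refl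

  inverse : Elt → Elt
  inverse z = [ N z ] · conj z

  ·-inverse : ∀ z → IsSign (N z) → z · inverse z ≡ 𝟙
  ·-inverse z ±1 = begin
    z · ([ N z ] · conj z)   ≡⟨ cong (z ·_) (·-comm [ N z ] (conj z)) ⟩
    z · (conj z · [ N z ])   ≡⟨ sym (·-assoc z (conj z) [ N z ]) ⟩
    z · conj z · [ N z ]     ≡⟨ cong (_· [ N z ]) (·-conj z) ⟩
    [ N z ] · [ N z ]        ≡⟨ [n]·[n] (N z) ⟩
    [ N z * N z ]            ≡⟨ cong [_] (sign-square ±1) ⟩
    𝟙                        ∎
    where open ≡-Reasoning

  ·≡𝟙⇒sign : ∀ z w → z · w ≡ 𝟙 → IsSign (N z)
  ·≡𝟙⇒sign z w zw≡𝟙 = *≡1⇒sign (trans (sym (norm-· z w)) (trans (cong N zw≡𝟙) norm-𝟙))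

  ·≡⇒≡·inverse : ∀ x y z → IsSign (N y) → x · y ≡ z → x ≡ z · inverse y
  ·≡⇒≡·inverse x y z ±1 xy≡z = begin
    x                    ≡⟨ sym (·-identityʳ x) ⟩
    x · 𝟙                ≡⟨ cong (x ·_) (sym (·-inverse y ±1)) ⟩
    x · (y · inverse y)  ≡⟨ sym (·-assoc x y (inverse y)) ⟩
    x · y · inverse y    ≡⟨ cong (_· inverse y) xy≡z ⟩
    z · inverse y        ∎
    where open ≡-Reasoning

  ·-cancelʳ : ∀ z x y → IsSign (N z) → x · z ≡ y · z → x ≡ y
  ·-cancelʳ z x y ±1 xz≡yz = trans (·≡⇒≡·inverse x z (y · z) ±1 xz≡yz) (sym (·≡⇒≡·inverse y z (y · z) ±1 refl))

  sign-norm-^ : ∀ z → IsSign (N z) → ∀ n → IsSign (N (z ^ n))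
  sign-norm-^ z ±1 zero = inj₁ norm-𝟙
  sign-norm-^ z ±1 (suc n) = subst IsSign (sym (norm-· z (z ^ n))) (sign-* ±1 (sign-norm-^ z ±1 n))

  IsPM1 : Elt → Set
  IsPM1 s = s ≡ 𝟙 ⊎ s ≡ negate 𝟙

  PM1-norm : ∀ {s} → IsPM1 s → N s ≡ 1ℤ
  PM1-norm (inj₁ refl) = norm-𝟙
  PM1-norm (inj₂ refl) = trans (norm-negate 𝟙) norm-𝟙

  PM1-square : ∀ {s} → IsPM1 s → s · s ≡ 𝟙
  PM1-square (inj₁ refl) = ·-identityˡ 𝟙
  PM1-square (inj₂ refl) =
    trans (negate-·ˡ 𝟙 (negate 𝟙)) (trans (cong negate (·-identityˡ (negate 𝟙))) (negate-involutive 𝟙))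

  PM1-negate : ∀ {s} → IsPM1 s → IsPM1 (negate s)
  PM1-negate (inj₁ refl) = inj₂ refl
  PM1-negate (inj₂ refl) = inj₁ (negate-involutive 𝟙)

  sign⇒PM1 : ∀ {n} → IsSign n → IsPM1 [ n ]
  sign⇒PM1 (inj₁ refl) = inj₁ refl
  sign⇒PM1 (inj₂ refl) = inj₂ refl

  InOrder-· : ∀ f {z w} → InOrder Δ f z → InOrder Δ f w → InOrder Δ f (z · w)
  InOrder-· f {x₁ , y₁} {x₂ , y₂} f∣y₁ f∣y₂ = ℤS.∣⇒∣ᵤ {i = x₁ * y₂ + x₂ * y₁ + d * (y₁ * y₂)}
    (ℤS.∣m∣n⇒∣m+n (ℤS.∣m∣n⇒∣m+n (ℤS.∣n⇒∣m*n x₁ f∣′y₂) (ℤS.∣n⇒∣m*n x₂ f∣′y₁))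
                  (ℤS.∣n⇒∣m*n d (ℤS.∣n⇒∣m*n y₁ f∣′y₂)))
    where
    f∣′y₁ = ℤS.∣ᵤ⇒∣ {+ f} {y₁} f∣y₁
    f∣′y₂ = ℤS.∣ᵤ⇒∣ {+ f} {y₂} f∣y₂

  InOrder-negate : ∀ f {z} → InOrder Δ f z → InOrder Δ f (negate z)
  InOrder-negate f {_ , y} f∣y = ℤS.∣⇒∣ᵤ {i = - y} (ℤS.∣m⇒∣-m (ℤS.∣ᵤ⇒∣ {+ f} {y} f∣y))

  InOrder-conj : ∀ f {z} → InOrder Δ f z → InOrder Δ f (conj z)
  InOrder-conj f {z} = InOrder-negate f {z}

  InOrder-[] : ∀ f n → InOrder Δ f [ n ]
  InOrder-[] f n = f ℕD.∣0

  InOrder-inverse : ∀ f {z} → InOrder Δ f z → InOrder Δ f (inverse z)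
  InOrder-inverse f {z} f∣y = InOrder-· f {[ N z ]} {conj z} (InOrder-[] f (N z)) (InOrder-conj f {z} f∣y)

  InOrder-PM1 : ∀ f {s} → IsPM1 s → InOrder Δ f s
  InOrder-PM1 f (inj₁ refl) = InOrder-[] f 1ℤ
  InOrder-PM1 f (inj₂ refl) = InOrder-[] f -1ℤ

  sign⇒Unit : ∀ f {z} → InOrder Δ f z → IsSign (N z) → Unit Δ f z
  sign⇒Unit f {z} z∈O ±1 = z∈O , inverse z , InOrder-inverse f {z} z∈O , ·-inverse z ±1

  sign⇒Unit1 : ∀ z → IsSign (N z) → Unit Δ 1 z
  sign⇒Unit1 z = sign⇒Unit 1 {z} (ℕD.1∣ _)

  √Δim·z≡z²-Nz : ∀ z → sqrtΔ* Δ (im z) · z ≡ _⊖_ Δ (z · z) [ N z ]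
  √Δim·z≡z²-Nz (x , y) = cong₂ _,_ (real c d x y) (irrational c d x y)
    where
    real : ∀ c d x y →
      (- (d * y)) * x - c * ((+ 2 * y) * y) ≡ (x * x - c * (y * y)) - (x * x + d * (x * y) + c * (y * y))
    real = solve-∀
    irrational : ∀ c d x y →
      (- (d * y)) * y + x * (+ 2 * y) + d * ((+ 2 * y) * y) ≡ (x * y + x * y + d * (y * y)) - 0ℤ
    irrational = solve-∀

  tr·z≡z²+Nz : ∀ z → [ tr z ] · z ≡ _⊕_ Δ (z · z) [ N z ]
  tr·z≡z²+Nz (x , y) = cong₂ _,_ (real c d x y) (irrational c d x y)
    where
    real : ∀ c d x y →
      (+ 2 * x + d * y) * x - c * (0ℤ * y) ≡ (x * x - c * (y * y)) + (x * x + d * (x * y) + c * (y * y))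
    real = solve-∀
    irrational : ∀ c d x y →
      (+ 2 * x + d * y) * y + x * 0ℤ + d * (0ℤ * y) ≡ (x * y + x * y + d * (y * y)) + 0ℤ
    irrational = solve-∀

  -- For E = ε^j of norm 1 the defining identities read f_j √Δ E = E² - N E and (d_j - 1) E = E² + N E.
  IsFSeq⇒im : ∀ {ε fF} → IsFSeq Δ ε fF → ∀ j → 1 ℕ.≤ j → N (ε ^ j) ≡ 1ℤ → fF j ≡ im (ε ^ j)
  IsFSeq⇒im {ε} {fF} fSeq j 1≤j NE≡1 =
    ℤP.*-cancelˡ-≡ (+ 2) (fF j) (im E) (cong proj₂ (·-cancelʳ E (sqrtΔ* Δ (fF j)) (sqrtΔ* Δ (im E)) (inj₁ NE≡1) fE≡imE))
    where
    E = ε ^ j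
    fE≡imE : sqrtΔ* Δ (fF j) · E ≡ sqrtΔ* Δ (im E) · E
    fE≡imE = begin
      sqrtΔ* Δ (fF j) · E          ≡⟨ fSeq j 1≤j ⟩
      _⊖_ Δ (ε ^ (2 ℕ.* j)) 𝟙      ≡⟨ cong₂ (_⊖_ Δ) (^-double ε j) (cong [_] (sym NE≡1)) ⟩
      _⊖_ Δ (E · E) [ N E ]        ≡⟨ sym (√Δim·z≡z²-Nz E) ⟩
      sqrtΔ* Δ (im E) · E          ∎
      where open ≡-Reasoning

  IsDSeq⇒tr : ∀ {ε dF} → IsDSeq Δ ε dF → ∀ j → 1 ℕ.≤ j → N (ε ^ j) ≡ 1ℤ → dF j - 1ℤ ≡ tr (ε ^ j)
  IsDSeq⇒tr {ε} {dF} dSeq j 1≤j NE≡1 = cong proj₁ (·-cancelʳ E [ dF j - 1ℤ ] [ tr E ] (inj₁ NE≡1) dE≡trE)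
    where
    E = ε ^ j
    dE≡trE : [ dF j - 1ℤ ] · E ≡ [ tr E ] · E
    dE≡trE = begin
      [ dF j - 1ℤ ] · E            ≡⟨ dSeq j 1≤j ⟩
      _⊕_ Δ (ε ^ (2 ℕ.* j)) 𝟙      ≡⟨ cong₂ (_⊕_ Δ) (^-double ε j) (cong [_] (sym NE≡1)) ⟩
      _⊕_ Δ (E · E) [ N E ]        ≡⟨ sym (tr·z≡z²+Nz E) ⟩
      [ tr E ] · E                 ∎
      where open ≡-Reasoning

  module _ (4c≡Δ²-Δ : + 4 * c ≡ d * d - d) where

    4N≡tr²-Δim² : ∀ z → + 4 * N z ≡ tr z * tr z - d * (im z * im z)
    4N≡tr²-Δim² (x , y) = ring-mod (cong (_* (y * y)) 4c≡Δ²-Δ) (identity c d x y)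
      where
      identity : ∀ c d x y → + 4 * (x * x + d * (x * y) + c * (y * y))
        ≡ ((+ 2 * x + d * y) * (+ 2 * x + d * y) - d * (y * y)) + (+ 4 * c * (y * y) - (d * d - d) * (y * y))
      identity = solve-∀

    tr-· : ∀ z w → + 2 * tr (z · w) ≡ tr z * tr w + d * (im z * im w)
    tr-· (x₁ , y₁) (x₂ , y₂) = ring-mod (cong (_* (- (y₁ * y₂))) 4c≡Δ²-Δ) (identity c d x₁ y₁ x₂ y₂)
      where
      identity : ∀ c d x₁ y₁ x₂ y₂ →
        + 2 * (+ 2 * (x₁ * x₂ - c * (y₁ * y₂)) + d * (x₁ * y₂ + x₂ * y₁ + d * (y₁ * y₂)))
        ≡ ((+ 2 * x₁ + d * y₁) * (+ 2 * x₂ + d * y₂) + d * (y₁ * y₂))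
          + (+ 4 * c * (- (y₁ * y₂)) - (d * d - d) * (- (y₁ * y₂)))
      identity = solve-∀

    tr-·conj : ∀ z w → + 2 * tr (z · conj w) ≡ tr w * tr z - d * (im w * im z)
    tr-·conj z w = trans (tr-· z (conj w))
      (trans (cong (λ t → tr z * t + d * (im z * - im w)) (tr-conj w)) (expand (tr z) (im z) (tr w) (im w) d))
      where
      expand : ∀ A B a b d → A * a + d * (B * - b) ≡ a * A - d * (b * B)
      expand = solve-∀

    4N≡-4 : ∀ z → N z ≡ -1ℤ → + 4 * -1ℤ ≡ tr z * tr z - d * (im z * im z)
    4N≡-4 z Nz≡-1 = trans (cong (+ 4 *_) (sym Nz≡-1)) (4N≡tr²-Δim² z)

    norm−1⇒tr-square : ∀ z → N z ≡ -1ℤ → tr (z · z) ≡ tr z * tr z + + 2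
    norm−1⇒tr-square z Nz≡-1 = ℤP.*-cancelˡ-≡ (+ 2) (tr (z · z)) (tr z * tr z + + 2)
      (ring-mod (tr-· z z) (ring-mod (4N≡-4 z Nz≡-1) (expand (tr (z · z)) (tr z) (im z) d)))
      where
      expand : ∀ T A B d → + 2 * T ≡ (+ 2 * (A * A + + 2) + (+ 2 * T - (A * A + d * (B * B)))) + (+ 4 * -1ℤ - (A * A - d * (B * B)))
      expand = solve-∀

    norm−1⇒im-square : ∀ z → N z ≡ -1ℤ → im z * im z * d ≡ tr (z · z) + + 2
    norm−1⇒im-square z Nz≡-1 =
      ring-mod (sym (norm−1⇒tr-square z Nz≡-1)) (ring-mod (4N≡-4 z Nz≡-1) (expand (tr (z · z)) (tr z) (im z) d))
      where
      expand : ∀ T A B d → B * B * d ≡ ((T + + 2) + ((A * A + + 2) - T)) + (+ 4 * -1ℤ - (A * A - d * (B * B)))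
      expand = solve-∀

    -- T ≡ Δt (mod 2) since (T - Δt)² is even, so w = (T + t√Δ)/2 is integral,
    -- and 4 N w = T² - Δt² = -4.
    root⇒norm−1 : ∀ T t D → T * T ≡ D - + 2 → t * t * d ≡ D + + 2 → Σ ℤ λ x → N (x , t) ≡ -1ℤ
    root⇒norm−1 T t D T²≡D-2 t²Δ≡D+2 = x , Nw≡-1
      where
      Q = (+ 2 * c + d) * (t * t) - + 2 - T * d * t
      [T-Δt]²≡2Q : (T - d * t) * (T - d * t) ≡ + 2 * Q
      [T-Δt]²≡2Q = ring-mod T²≡D-2 (ring-mod (sym t²Δ≡D+2) (ring-mod (cong (_* (t * t)) (sym 4c≡Δ²-Δ)) (expand T d t D c)))
        where
        expand : ∀ T d t D c → (T - d * t) * (T - d * t)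
          ≡ ((+ 2 * ((+ 2 * c + d) * (t * t) - + 2 - T * d * t) + (T * T - (D - + 2))) + ((D + + 2) - t * t * d))
            + ((d * d - d) * (t * t) - + 4 * c * (t * t))
        expand = solve-∀
      2∣T-Δt : + 2 ℤS.∣ T - d * t
      2∣T-Δt = ℤS.∣ᵤ⇒∣ {+ 2} {T - d * t} (2∣m*m⇒2∣m ℤ.∣ T - d * t ∣
                 (subst (2 ℕD.∣_) (ℤP.abs-* (T - d * t) (T - d * t))
                   (ℤS.∣⇒∣ᵤ {+ 2} {(T - d * t) * (T - d * t)} (ℤS.divides Q (trans [T-Δt]²≡2Q (ℤP.*-comm (+ 2) Q))))))
      x = ℤS._∣_.quotient 2∣T-Δt
      trw≡T : tr (x , t) ≡ T
      trw≡T = ring-mod (sym (ℤS._∣_.equality 2∣T-Δt)) (expand x T d t)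
        where
        expand : ∀ x T d t → + 2 * x + d * t ≡ T + (x * + 2 - (T - d * t))
        expand = solve-∀
      Nw≡-1 : N (x , t) ≡ -1ℤ
      Nw≡-1 = ℤP.*-cancelˡ-≡ (+ 4) (N (x , t)) -1ℤ (trans (4N≡tr²-Δim² (x , t))
                (trans (cong (λ y → y * y - d * (t * t)) trw≡T)
                  (ring-mod T²≡D-2 (ring-mod (sym t²Δ≡D+2) (expand T d t D)))))
        where
        expand : ∀ T d t D → T * T - d * (t * t) ≡ ((+ 4 * -1ℤ + (T * T - (D - + 2))) + ((D + + 2) - t * t * d))
        expand = solve-∀

    -- N E = 1 and Δ t² = tr E + 2 give (im E)² = (tr E - 2) t², so tr E - 2 is a square.
    norm-1⇒norm−1 : .{{_ : ℕ.NonZero Δ}} → ∀ E t .{{_ : ℕ.NonZero t}} → N E ≡ 1ℤ →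
                    + t * + t * d ≡ tr E + + 2 → Σ ℤ λ x → N (x , + t) ≡ -1ℤ
    norm-1⇒norm−1 E t NE≡1 t²Δ≡D+2 = from-root (square-ratio⇒square (im E) (tr E - + 2) t F²≡[D-2]t²)
      where
      F²≡[D-2]t² : im E * im E ≡ (tr E - + 2) * (+ t * + t)
      F²≡[D-2]t² = ℤP.*-cancelˡ-≡ d (im E * im E) ((tr E - + 2) * (+ t * + t))
        (ring-mod (trans (cong (+ 4 *_) (sym NE≡1)) (4N≡tr²-Δim² E))
          (ring-mod (cong (λ y → - (tr E - + 2) * y) t²Δ≡D+2) (expand (tr E) (im E) (+ t * + t) d)))
        where
        expand : ∀ D F T2 d → d * (F * F)
          ≡ (d * ((D - + 2) * T2) + (+ 4 * 1ℤ - (D * D - d * (F * F)))) + (- (D - + 2) * (T2 * d) - - (D - + 2) * (D + + 2))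
        expand = solve-∀
      from-root : Σ ℤ (λ T → T * T ≡ tr E - + 2) → Σ ℤ λ x → N (x , + t) ≡ -1ℤ
      from-root (T , T²≡D-2) = root⇒norm−1 T (+ t) (tr E) T²≡D-2 t²Δ≡D+2


-- Integer solutions of A² = ΔB² ± 4, i.e. coordinates of units (A + B√Δ)/2;
-- only Δ ≥ 5 is used.
module Pell (Δ : ℕ) (0≤Δ-5 : 0ℤ ≤ + Δ - + 5) where

  d : ℤ
  d = + Δ

  PellEq : ℤ → ℤ → ℤ → Set
  PellEq A B s = A * A ≡ d * (B * B) + + 4 * s

  0<Δ : 0ℤ < d
  0<Δ = 0<-witness _ (+-nonNeg (0≤+ 4) 0≤Δ-5) (expand d)
    where
    expand : ∀ d → d ≡ 1ℤ + (+ 4 + (d - + 5))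
    expand = solve-∀

  pell-Pos⇒pos : ∀ {A B s} → IsSign s → PellEq A B s → Pos Δ (A - + 2) B → 0ℤ < A × 0ℤ < B
  pell-Pos⇒pos {A} {B} {s} ±1 eq (inj₁ (0<A-2 , +≤+ {n = zero} _)) =
    ⊥-elim (1+nonNeg≢0 _ 0≤r (ring-mod eq (expand A d s)))
    where
    k = 0<i⇒0≤i-1 0<A-2
    0≤r = +-nonNeg (+-nonNeg (+-nonNeg (0≤+ 4) (*-nonNeg (0≤+ 6) k)) (*-nonNeg k k)) (*-nonNeg (0≤+ 4) (sign⇒0≤1-s ±1))
    expand : ∀ A d s → 1ℤ + (+ 4 + + 6 * (A - + 2 - 1ℤ) + (A - + 2 - 1ℤ) * (A - + 2 - 1ℤ) + + 4 * (1ℤ - s))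
                      ≡ 0ℤ + (A * A - (d * (0ℤ * 0ℤ) + + 4 * s))
    expand = solve-∀
  pell-Pos⇒pos {A} ±1 eq (inj₁ (0<A-2 , +≤+ {n = suc n} _)) =
    0<-witness _ (+-nonNeg (0≤+ 2) (0<i⇒0≤i-1 0<A-2)) (expand A) , +<+ (ℕ.s≤s ℕ.z≤n)
    where
    expand : ∀ A → A ≡ 1ℤ + (+ 2 + (A - + 2 - 1ℤ))
    expand = solve-∀
  pell-Pos⇒pos {A} ±1 eq (inj₂ (inj₁ (0≤A-2 , 0<B))) = 0<-witness _ (+-nonNeg (0≤+ 1) 0≤A-2) (expand A) , 0<B
    where
    expand : ∀ A → A ≡ 1ℤ + (+ 1 + (A - + 2))
    expand = solve-∀
  pell-Pos⇒pos {A} {B} {s} ±1 eq (inj₂ (inj₂ (inj₁ (0<A-2 , _ , ΔB²<[A-2]²)))) =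
    ⊥-elim (ℤP.<⇒≱ ΔB²<[A-2]² (≤-witness _ 0≤r (ring-mod (sym eq) (expand A B d s))))
    where
    k = 0<i⇒0≤i-1 0<A-2
    0≤r = +-nonNeg (+-nonNeg (0≤+ 4) (*-nonNeg (0≤+ 4) k)) (*-nonNeg (0≤+ 4) (sign⇒0≤1-s ±1))
    expand : ∀ A B d s → d * (B * B) - (A - + 2) * (A - + 2)
      ≡ (+ 4 + + 4 * (A - + 2 - 1ℤ) + + 4 * (1ℤ - s)) + ((d * (B * B) + + 4 * s) - A * A)
    expand = solve-∀
  pell-Pos⇒pos {A} {B} {s} ±1 eq (inj₂ (inj₂ (inj₂ (_ , 0<B , [A-2]²<ΔB²)))) = ℤP.≰⇒> A≰0 , 0<B
    where
    expand : ∀ A B d s → (A - + 2) * (A - + 2) - d * (B * B)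
      ≡ (+ 4 * (0ℤ - A) + + 4 * (1ℤ + s)) + (A * A - (d * (B * B) + + 4 * s))
    expand = solve-∀
    A≰0 : ¬ A ≤ 0ℤ
    A≰0 A≤0 = ℤP.<⇒≱ [A-2]²<ΔB² (≤-witness _ 0≤r (ring-mod eq (expand A B d s)))
      where
      0≤r = +-nonNeg (*-nonNeg (0≤+ 4) (ℤP.i≤j⇒0≤j-i A≤0)) (*-nonNeg (0≤+ 4) (sign⇒0≤1+s ±1))

  pos⇒Pos : ∀ {A B} → 0ℤ < A → 0ℤ < B → Pos Δ (A - + 2) B
  pos⇒Pos {A} {B} 0<A 0<B with + 2 ℤP.≤? A
  ... | yes 2≤A = inj₂ (inj₁ (ℤP.i≤j⇒0≤j-i 2≤A , 0<B))
  ... | no 2≰A = A≡1 0<A (ℤP.≰⇒> 2≰A)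
    where
    k = 0<i⇒0≤i-1 0<B
    0≤r = +-nonNeg (+-nonNeg (0≤+ 3) (*-nonNeg 0≤Δ-5 (*-nonNeg (ℤP.<⇒≤ 0<B) (ℤP.<⇒≤ 0<B))))
                   (*-nonNeg (0≤+ 5) (+-nonNeg (*-nonNeg k k) (*-nonNeg (0≤+ 2) k)))
    expand : ∀ B d → d * (B * B) - 1ℤ ≡ 1ℤ + (+ 3 + (d - + 5) * (B * B) + + 5 * ((B - 1ℤ) * (B - 1ℤ) + + 2 * (B - 1ℤ)))
    expand = solve-∀
    A≡1 : 0ℤ < A → A < + 2 → Pos Δ (A - + 2) B
    A≡1 (+<+ {n = 1} _) _ = inj₂ (inj₂ (inj₂ (-<+ , 0<B , <-witness _ 0≤r (expand B d))))
    A≡1 (+<+ {n = suc (suc _)} _) (+<+ (ℕ.s≤s (ℕ.s≤s ())))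

  pell-im<⇒tr< : ∀ {A₁ B₁ s₁ A₂ B₂ s₂} → IsSign s₁ → IsSign s₂ → PellEq A₁ B₁ s₁ → PellEq A₂ B₂ s₂ →
                 0ℤ < B₁ → 0ℤ < A₂ → B₁ < B₂ → A₁ < A₂
  pell-im<⇒tr< {A₁} {B₁} {s₁} {A₂} {B₂} {s₂} ±1₁ ±1₂ eq₁ eq₂ 0<B₁ 0<A₂ B₁<B₂ =
    square-<⇒< 0<A₂ (<-witness _ 0≤r (ring-mod eq₂ (ring-mod (sym eq₁) (expand A₁ B₁ s₁ A₂ B₂ s₂ d))))
    where
    k = i<j⇒0≤j-i-1 B₁<B₂
    b = 0<i⇒0≤i-1 0<B₁
    Q = +-nonNeg (+-nonNeg (+-nonNeg (*-nonNeg (0≤+ 2) b) (*-nonNeg (0≤+ 4) k)) (*-nonNeg (*-nonNeg (0≤+ 2) b) k)) (*-nonNeg k k)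
    0≤r = +-nonNeg (+-nonNeg (+-nonNeg (+-nonNeg (0≤+ 6) (*-nonNeg (0≤+ 5) Q))
            (*-nonNeg 0≤Δ-5 (*-nonNeg (+-nonNeg (0≤+ 1) k) (+-nonNeg (+-nonNeg (0≤+ 3) (*-nonNeg (0≤+ 2) b)) k))))
            (*-nonNeg (0≤+ 4) (sign⇒0≤1+s ±1₂))) (*-nonNeg (0≤+ 4) (sign⇒0≤1-s ±1₁))
    expand : ∀ A₁ B₁ s₁ A₂ B₂ s₂ d →
      A₂ * A₂ - A₁ * A₁ ≡ ((1ℤ + (+ 6 + + 5 * (+ 2 * (B₁ - 1ℤ) + + 4 * (B₂ - B₁ - 1ℤ) + + 2 * (B₁ - 1ℤ) * (B₂ - B₁ - 1ℤ)
                                              + (B₂ - B₁ - 1ℤ) * (B₂ - B₁ - 1ℤ))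
          + (d - + 5) * ((1ℤ + (B₂ - B₁ - 1ℤ)) * (+ 3 + + 2 * (B₁ - 1ℤ) + (B₂ - B₁ - 1ℤ))) + + 4 * (1ℤ + s₂) + + 4 * (1ℤ - s₁)))
        + (A₂ * A₂ - (d * (B₂ * B₂) + + 4 * s₂))) + ((d * (B₁ * B₁) + + 4 * s₁) - A₁ * A₁)
    expand = solve-∀

  pell-tr<Δim : ∀ {A B s} → IsSign s → PellEq A B s → 0ℤ < B → A < d * B
  pell-tr<Δim {A} {B} {s} ±1 eq 0<B = square-<⇒< 0<ΔB (<-witness _ 0≤r (ring-mod (sym eq) (expand A B s d)))
    where
    b = 0<i⇒0≤i-1 0<B
    B≥0 = ℤP.<⇒≤ 0<B
    0<ΔB : 0ℤ < d * B
    0<ΔB = 0<-witness _ (+-nonNeg (+-nonNeg (0≤+ 4) (*-nonNeg (0≤+ 5) b)) (*-nonNeg 0≤Δ-5 B≥0)) (expand′ B d)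
      where
      expand′ : ∀ B d → d * B ≡ 1ℤ + (+ 4 + + 5 * (B - 1ℤ) + (d - + 5) * B)
      expand′ = solve-∀
    0≤r = +-nonNeg (+-nonNeg (+-nonNeg (0≤+ 15) (*-nonNeg (0≤+ 20) (+-nonNeg (*-nonNeg (0≤+ 2) b) (*-nonNeg b b))))
            (*-nonNeg (+-nonNeg (*-nonNeg (0≤+ 9) 0≤Δ-5) (*-nonNeg 0≤Δ-5 0≤Δ-5)) (*-nonNeg B≥0 B≥0)))
            (*-nonNeg (0≤+ 4) (sign⇒0≤1-s ±1))
    expand : ∀ A B s d → (d * B) * (d * B) - A * A
      ≡ (1ℤ + (+ 15 + + 20 * (+ 2 * (B - 1ℤ) + (B - 1ℤ) * (B - 1ℤ)) + (+ 9 * (d - + 5) + (d - + 5) * (d - + 5)) * (B * B)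
              + + 4 * (1ℤ - s))) + ((d * (B * B) + + 4 * s) - A * A)
    expand = solve-∀

  2A′≡Aa+ΔBb⇒A<A′ : ∀ {A B a b A′} → 0ℤ < A → 0ℤ < B → 0ℤ < a → 0ℤ < b → A < d * B →
                    + 2 * A′ ≡ A * a + d * (B * b) → A < A′
  2A′≡Aa+ΔBb⇒A<A′ {A} {B} {a} {b} {A′} 0<A 0<B 0<a 0<b A<ΔB eq =
    0<j-i⇒i<j (ℤP.*-cancelˡ-<-nonNeg (+ 2) (0<-witness _ 0≤r (ring-mod eq (expand A B a b A′ d))))
    where
    0≤r = +-nonNeg (+-nonNeg (i<j⇒0≤j-i-1 A<ΔB) (*-nonNeg (ℤP.<⇒≤ 0<A) (0<i⇒0≤i-1 0<a)))
                   (*-nonNeg (*-nonNeg (ℤP.<⇒≤ 0<Δ) (ℤP.<⇒≤ 0<B)) (0<i⇒0≤i-1 0<b))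
    expand : ∀ A B a b A′ d → + 2 * (A′ - A)
      ≡ (1ℤ + ((d * B - A - 1ℤ) + A * (a - 1ℤ) + d * B * (b - 1ℤ))) + (+ 2 * A′ - (A * a + d * (B * b)))
    expand = solve-∀

  pell-tr<⇒im≤ : ∀ {a b s A B t} → IsSign s → IsSign t → PellEq a b s → PellEq A B t →
                 0ℤ < a → 0ℤ < B → a < A → b ≤ B
  pell-tr<⇒im≤ ±1s ±1t eqa eqA 0<a 0<B a<A = ℤP.≮⇒≥ λ B<b →
    ℤP.<-asym a<A (pell-im<⇒tr< ±1t ±1s eqA eqa 0<B 0<a B<b)

  pell-tr<⇒im< : ∀ {a b s A B t} → PellEq a b s → PellEq A B t → + 4 * t - + 4 * s ≤ 0ℤ →
                 0ℤ < a → a < A → b ≤ B → b < B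
  pell-tr<⇒im< {a} {b} {s} {A} {B} {t} eqa eqA 4t-4s≤0 0<a a<A b≤B with ℤP.<-cmp b B
  ... | tri< b<B _ _ = b<B
  ... | tri> _ _ B<b = ⊥-elim (ℤP.<⇒≱ B<b b≤B)
  ... | tri≈ _ refl _ = ⊥-elim (ℤP.<⇒≱ (subst (0ℤ <_) A²-a²≡4t-4s (i<j⇒0<j-i (<⇒square-< 0<a a<A))) 4t-4s≤0)
    where
    expand : ∀ a A B s t d → A * A - a * a
      ≡ ((+ 4 * t - + 4 * s) + ((d * (B * B) + + 4 * s) - a * a)) + (A * A - (d * (B * B) + + 4 * t))
    expand = solve-∀
    A²-a²≡4t-4s : A * A - a * a ≡ + 4 * t - + 4 * s
    A²-a²≡4t-4s = ring-mod (sym eqa) (ring-mod eqA (expand a A B s t d))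

  pell-cross-tr : ∀ a b s A B t → PellEq a b s → PellEq A B t →
    (a * A) * (a * A) - (d * (b * B)) * (d * (b * B)) ≡ + 4 * d * (t * (b * b) + s * (B * B)) + + 16 * s * t
  pell-cross-tr a b s A B t eqa eqA =
    ring-mod (cong (_* (A * A)) eqa) (ring-mod (cong ((d * (b * b) + + 4 * s) *_) eqA) (expand a b s A B t d))
    where
    expand : ∀ a b s A B t d → (a * A) * (a * A) - (d * (b * B)) * (d * (b * B))
      ≡ ((+ 4 * d * (t * (b * b) + s * (B * B)) + + 16 * s * t)
          + (a * a * (A * A) - (d * (b * b) + + 4 * s) * (A * A)))
        + ((d * (b * b) + + 4 * s) * (A * A) - (d * (b * b) + + 4 * s) * (d * (B * B) + + 4 * t))
    expand = solve-∀

  pell-cross-im : ∀ a b s A B t → PellEq a b s → PellEq A B t →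
    (a * B) * (a * B) - (A * b) * (A * b) ≡ + 4 * s * (B * B) - + 4 * t * (b * b)
  pell-cross-im a b s A B t eqa eqA =
    ring-mod (cong (_* (B * B)) eqa) (ring-mod (cong (_* (b * b)) (sym eqA)) (expand a b s A B t d))
    where
    expand : ∀ a b s A B t d → (a * B) * (a * B) - (A * b) * (A * b)
      ≡ ((+ 4 * s * (B * B) - + 4 * t * (b * b)) + (a * a * (B * B) - (d * (b * b) + + 4 * s) * (B * B)))
        + ((d * (B * B) + + 4 * t) * (b * b) - A * A * (b * b))
    expand = solve-∀

  -- For units 1 < u = (a + b√Δ)/2 < z = (A + B√Δ)/2 one has
  -- z/u = N u ((aA - ΔbB) + (aB - Ab)√Δ)/4; these are the signs making z/u > 1.
  pell-quotient-norm+ : ∀ {a b A B t} → IsSign t → PellEq a b 1ℤ → PellEq A B t →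
                        0ℤ < a → 0ℤ < b → 0ℤ < A → 0ℤ < B → a < A →
                        d * (b * B) < a * A × A * b < a * B
  pell-quotient-norm+ {a} {b} {A} {B} (inj₁ refl) eqa eqA 0<a 0<b 0<A 0<B a<A =
    <-by-squares _ (*-pos 0<a 0<A) (pell-cross-tr a b 1ℤ A B 1ℤ eqa eqA) (0<-witness _ 0≤r (expand b B d)) ,
    <-by-squares _ (*-pos 0<a 0<B) (pell-cross-im a b 1ℤ A B 1ℤ eqa eqA) (0<b<B⇒0<4B²-4b² 0<b b<B)
    where
    b<B : b < B
    b<B = pell-tr<⇒im< {s = 1ℤ} {t = 1ℤ} eqa eqA ℤP.≤-refl 0<a a<A
            (pell-tr<⇒im≤ (inj₁ refl) (inj₁ refl) eqa eqA 0<a 0<B a<A)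
    0≤r = +-nonNeg (+-nonNeg (0≤+ 15) (*-nonNeg (*-nonNeg (0≤+ 4) (ℤP.<⇒≤ 0<Δ)) (square-nonNeg b)))
                   (*-nonNeg (*-nonNeg (0≤+ 4) (ℤP.<⇒≤ 0<Δ)) (square-nonNeg B))
    expand : ∀ b B d → + 4 * d * (1ℤ * (b * b) + 1ℤ * (B * B)) + + 16 * 1ℤ * 1ℤ
                      ≡ 1ℤ + (+ 15 + + 4 * d * (b * b) + + 4 * d * (B * B))
    expand = solve-∀
  pell-quotient-norm+ {a} {b} {A} {B} (inj₂ refl) eqa eqA 0<a 0<b 0<A 0<B a<A =
    <-by-squares _ (*-pos 0<a 0<A) (pell-cross-tr a b 1ℤ A B -1ℤ eqa eqA) (0<-witness _ 0≤r₁ (expand₁ b B d)) ,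
    <-by-squares _ (*-pos 0<a 0<B) (pell-cross-im a b 1ℤ A B -1ℤ eqa eqA) (0<-witness _ 0≤r₂ (expand₂ b B))
    where
    b<B : b < B
    b<B = pell-tr<⇒im< {s = 1ℤ} {t = -1ℤ} eqa eqA -≤+ 0<a a<A (pell-tr<⇒im≤ (inj₁ refl) (inj₂ refl) eqa eqA 0<a 0<B a<A)
    k = i<j⇒0≤j-i-1 b<B
    b≥0 = ℤP.<⇒≤ 0<b
    b-1≥0 = 0<i⇒0≤i-1 0<b
    B²-b²-1≥0 = +-nonNeg (+-nonNeg (+-nonNeg (*-nonNeg (0≤+ 2) b≥0) (*-nonNeg (*-nonNeg (0≤+ 2) b≥0) k))
                                   (*-nonNeg (0≤+ 2) k)) (*-nonNeg k k)
    0≤r₁ = +-nonNeg (+-nonNeg (0≤+ 3) (*-nonNeg (0≤+ 20) B²-b²-1≥0))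
                    (*-nonNeg (*-nonNeg (0≤+ 4) 0≤Δ-5) (+-nonNeg (0≤+ 1) B²-b²-1≥0))
    expand₁ : ∀ b B d → + 4 * d * (-1ℤ * (b * b) + 1ℤ * (B * B)) + + 16 * 1ℤ * -1ℤ ≡
      1ℤ + (+ 3 + + 20 * (+ 2 * b + + 2 * b * (B - b - 1ℤ) + + 2 * (B - b - 1ℤ) + (B - b - 1ℤ) * (B - b - 1ℤ))
           + + 4 * (d - + 5) * (1ℤ + (+ 2 * b + + 2 * b * (B - b - 1ℤ) + + 2 * (B - b - 1ℤ) + (B - b - 1ℤ) * (B - b - 1ℤ))))
    expand₁ = solve-∀
    0≤r₂ = +-nonNeg (+-nonNeg (0≤+ 3) (*-nonNeg (0≤+ 4) (square-nonNeg B)))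
                    (*-nonNeg (0≤+ 4) (+-nonNeg (*-nonNeg b-1≥0 b-1≥0) (*-nonNeg (0≤+ 2) b-1≥0)))
    expand₂ : ∀ b B → + 4 * 1ℤ * (B * B) - + 4 * -1ℤ * (b * b)
                      ≡ 1ℤ + (+ 3 + + 4 * (B * B) + + 4 * ((b - 1ℤ) * (b - 1ℤ) + + 2 * (b - 1ℤ)))
    expand₂ = solve-∀

  pell-quotient-norm- : ∀ {a b A B t} → IsSign t → PellEq a b -1ℤ → PellEq A B t →
                        0ℤ < a → 0ℤ < b → 0ℤ < A → 0ℤ < B → a < A →
                        a * A < d * (b * B) × a * B < A * b
  pell-quotient-norm- {a} {b} {A} {B} (inj₁ refl) eqa eqA 0<a 0<b 0<A 0<B a<A =
    <-by-squares _ (*-pos 0<Δ (*-pos 0<b 0<B)) (squares-swap (a * A) (d * (b * B)) (pell-cross-tr a b -1ℤ A B 1ℤ eqa eqA))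
                 (0<-witness _ 0≤r₁ (expand₁ b B d)) ,
    <-by-squares _ (*-pos 0<A 0<b) (squares-swap (a * B) (A * b) (pell-cross-im a b -1ℤ A B 1ℤ eqa eqA))
                 (0<-witness _ 0≤r₂ (expand₂ b B))
    where
    B-b≥0 = ℤP.i≤j⇒0≤j-i (pell-tr<⇒im≤ (inj₂ refl) (inj₁ refl) eqa eqA 0<a 0<B a<A)
    b-1≥0 = 0<i⇒0≤i-1 0<b
    0≤r₁ = +-nonNeg (0≤+ 15) (*-nonNeg (*-nonNeg (0≤+ 4) (ℤP.<⇒≤ 0<Δ))
             (+-nonNeg (*-nonNeg (*-nonNeg (0≤+ 2) (ℤP.<⇒≤ 0<b)) B-b≥0) (*-nonNeg B-b≥0 B-b≥0)))
    expand₁ : ∀ b B d → - (+ 4 * d * (1ℤ * (b * b) + -1ℤ * (B * B)) + + 16 * -1ℤ * 1ℤ) ≡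
      1ℤ + (+ 15 + + 4 * d * (+ 2 * b * (B - b) + (B - b) * (B - b)))
    expand₁ = solve-∀
    0≤r₂ = +-nonNeg (+-nonNeg (0≤+ 3) (*-nonNeg (0≤+ 4) (square-nonNeg B)))
                    (*-nonNeg (0≤+ 4) (+-nonNeg (*-nonNeg b-1≥0 b-1≥0) (*-nonNeg (0≤+ 2) b-1≥0)))
    expand₂ : ∀ b B → - (+ 4 * -1ℤ * (B * B) - + 4 * 1ℤ * (b * b))
                      ≡ 1ℤ + (+ 3 + + 4 * (B * B) + + 4 * ((b - 1ℤ) * (b - 1ℤ) + + 2 * (b - 1ℤ)))
    expand₂ = solve-∀
  pell-quotient-norm- {a} {b} {A} {B} (inj₂ refl) eqa eqA 0<a 0<b 0<A 0<B a<A =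
    <-by-squares _ (*-pos 0<Δ (*-pos 0<b 0<B)) (squares-swap (a * A) (d * (b * B)) (pell-cross-tr a b -1ℤ A B -1ℤ eqa eqA))
                 (0<-witness _ 0≤r₁ (expand₁ b B d)) ,
    <-by-squares _ (*-pos 0<A 0<b) (trans (squares-swap (a * B) (A * b) (pell-cross-im a b -1ℤ A B -1ℤ eqa eqA)) (expand₂ b B))
                 (0<b<B⇒0<4B²-4b² 0<b b<B)
    where
    b<B : b < B
    b<B = pell-tr<⇒im< {s = -1ℤ} {t = -1ℤ} eqa eqA ℤP.≤-refl 0<a a<A
            (pell-tr<⇒im≤ (inj₂ refl) (inj₂ refl) eqa eqA 0<a 0<B a<A)
    b-1≥0 = 0<i⇒0≤i-1 0<b
    B-1≥0 = 0<i⇒0≤i-1 0<B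
    0≤r₁ = +-nonNeg (+-nonNeg (+-nonNeg (0≤+ 23)
                                        (*-nonNeg (*-nonNeg (0≤+ 4) 0≤Δ-5) (+-nonNeg (square-nonNeg b) (square-nonNeg B))))
             (*-nonNeg (0≤+ 20) (+-nonNeg (*-nonNeg b-1≥0 b-1≥0) (*-nonNeg (0≤+ 2) b-1≥0))))
             (*-nonNeg (0≤+ 20) (+-nonNeg (*-nonNeg B-1≥0 B-1≥0) (*-nonNeg (0≤+ 2) B-1≥0)))
    expand₁ : ∀ b B d → - (+ 4 * d * (-1ℤ * (b * b) + -1ℤ * (B * B)) + + 16 * -1ℤ * -1ℤ) ≡
      1ℤ + (+ 23 + + 4 * (d - + 5) * (b * b + B * B) + + 20 * ((b - 1ℤ) * (b - 1ℤ) + + 2 * (b - 1ℤ))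
           + + 20 * ((B - 1ℤ) * (B - 1ℤ) + + 2 * (B - 1ℤ)))
    expand₁ = solve-∀
    expand₂ : ∀ b B → - (+ 4 * -1ℤ * (B * B) - + 4 * -1ℤ * (b * b)) ≡ + 4 * (B * B) - + 4 * (b * b)
    expand₂ = solve-∀

  pell-tr≢0 : ∀ B s → IsSign s → PellEq 0ℤ B s → 0ℤ < B → ⊥
  pell-tr≢0 B s (inj₁ refl) eq 0<B = 1+nonNeg≢0 _ 0≤r (sym (trans eq (expand B d)))
    where
    0≤r = +-nonNeg (0≤+ 3) (*-nonNeg (ℤP.<⇒≤ 0<Δ) (square-nonNeg B))
    expand : ∀ B d → d * (B * B) + + 4 * 1ℤ ≡ 1ℤ + (+ 3 + d * (B * B))
    expand = solve-∀
  pell-tr≢0 B s (inj₂ refl) eq 0<B = 1+nonNeg≢0 _ 0≤r (sym (trans eq (expand B d)))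
    where
    b = 0<i⇒0≤i-1 0<B
    0≤r = +-nonNeg (*-nonNeg 0≤Δ-5 (square-nonNeg B)) (*-nonNeg (0≤+ 5) (+-nonNeg (*-nonNeg b b) (*-nonNeg (0≤+ 2) b)))
    expand : ∀ B d → d * (B * B) + + 4 * -1ℤ ≡ 1ℤ + ((d - + 5) * (B * B) + + 5 * ((B - 1ℤ) * (B - 1ℤ) + + 2 * (B - 1ℤ)))
    expand = solve-∀

  pell-im≡0 : ∀ A s → IsSign s → PellEq A 0ℤ s → A ≡ + 2 ⊎ A ≡ - + 2
  pell-im≡0 A s (inj₁ refl) eq with ℤP.i*j≡0⇒i≡0∨j≡0 (A - + 2) (ring-mod eq (expand A d))
    where
    expand : ∀ A d → (A - + 2) * (A + + 2) ≡ 0ℤ + (A * A - (d * (0ℤ * 0ℤ) + + 4 * 1ℤ))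
    expand = solve-∀
  ... | inj₁ A-2≡0 = inj₁ (ℤP.i-j≡0⇒i≡j A (+ 2) A-2≡0)
  ... | inj₂ A+2≡0 = inj₂ (ring-mod A+2≡0 (expand A))
    where
    expand : ∀ A → A ≡ - + 2 + ((A + + 2) - 0ℤ)
    expand = solve-∀
  pell-im≡0 A s (inj₂ refl) eq = ⊥-elim (1+nonNeg≢0 _ (+-nonNeg (0≤+ 3) (square-nonNeg A)) (ring-mod eq (expand A d)))
    where
    expand : ∀ A d → 1ℤ + (+ 3 + A * A) ≡ 0ℤ + (A * A - (d * (0ℤ * 0ℤ) + + 4 * -1ℤ))
    expand = solve-∀


module UnitOrder (Δ : ℕ) (4c≡Δ²-Δ : + 4 * cω Δ ≡ + Δ * + Δ - + Δ) (0≤Δ-5 : 0ℤ ≤ + Δ - + 5) where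

  open QuadraticRing Δ
  open Pell Δ 0≤Δ-5 hiding (d)

  pellEq : ∀ z → PellEq (tr z) (im z) (N z)
  pellEq z = ring-mod (sym (4N≡tr²-Δim² 4c≡Δ²-Δ z)) (expand (tr z) (im z) (N z) d)
    where
    expand : ∀ A B n d → A * A ≡ (d * (B * B) + + 4 * n) + ((A * A - d * (B * B)) - + 4 * n)
    expand = solve-∀

  PosCoords : Elt → Set
  PosCoords z = 0ℤ < tr z × 0ℤ < im z

  ≺⇒Pos : ∀ z w → _≺_ Δ z w → Pos Δ (tr w - tr z) (im w - im z)
  ≺⇒Pos (x₁ , y₁) (x₂ , y₂) = subst₂ (Pos Δ) (expand x₁ y₁ x₂ y₂ d) refl
    where
    expand : ∀ x₁ y₁ x₂ y₂ d → + 2 * (x₂ - x₁) + d * (y₂ - y₁) ≡ (+ 2 * x₂ + d * y₂) - (+ 2 * x₁ + d * y₁)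
    expand = solve-∀

  1≺⇒PosCoords : ∀ z → IsSign (N z) → _≺_ Δ 𝟙 z → PosCoords z
  1≺⇒PosCoords z ±1 𝟙≺z =
    pell-Pos⇒pos ±1 (pellEq z) (subst₂ (Pos Δ) (cong (λ t → tr z - t) tr-𝟙) (ℤP.+-identityʳ (im z)) (≺⇒Pos 𝟙 z 𝟙≺z))

  PosCoords⇒1≺ : ∀ z → PosCoords z → _≺_ Δ 𝟙 z
  PosCoords⇒1≺ (x , y) (0<A , 0<B) = subst₂ (Pos Δ) (expand x y d) (sym (ℤP.+-identityʳ y)) (pos⇒Pos 0<A 0<B)
    where
    expand : ∀ x y d → + 2 * x + d * y - + 2 ≡ + 2 * (x - 1ℤ) + d * (y - 0ℤ)
    expand = solve-∀

  im<⇒tr< : ∀ z w → IsSign (N z) → IsSign (N w) → 0ℤ < im z → 0ℤ < tr w → im z < im w → tr z < tr w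
  im<⇒tr< z w ±1z ±1w = pell-im<⇒tr< {tr z} {im z} {N z} {tr w} {im w} {N w} ±1z ±1w (pellEq z) (pellEq w)

  ≼⇒tr≤ : ∀ z w → IsSign (N z) → IsSign (N w) → PosCoords z → PosCoords w → _≼_ Δ z w → tr z ≤ tr w
  ≼⇒tr≤ z w ±1z ±1w pz pw (inj₂ refl) = ℤP.≤-refl
  ≼⇒tr≤ z w ±1z ±1w pz pw (inj₁ z≺w) = from-Pos (≺⇒Pos z w z≺w)
    where
    from-Pos : Pos Δ (tr w - tr z) (im w - im z) → tr z ≤ tr w
    from-Pos (inj₁ (0<Δtr , _)) = ℤP.0≤i-j⇒j≤i (ℤP.<⇒≤ 0<Δtr)
    from-Pos (inj₂ (inj₁ (0≤Δtr , _))) = ℤP.0≤i-j⇒j≤i 0≤Δtr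
    from-Pos (inj₂ (inj₂ (inj₁ (0<Δtr , _)))) = ℤP.0≤i-j⇒j≤i (ℤP.<⇒≤ 0<Δtr)
    from-Pos (inj₂ (inj₂ (inj₂ (_ , 0<Δim , _)))) =
      ℤP.<⇒≤ (im<⇒tr< z w ±1z ±1w (proj₂ pz) (proj₁ pw) (0<j-i⇒i<j 0<Δim))

  private
    half-pos : ∀ {w e} → + 2 * w ≡ e → 0ℤ < e → 0ℤ < w
    half-pos refl 0<e = ℤP.*-cancelˡ-<-nonNeg (+ 2) 0<e

    half-neg : ∀ {w e} → + 2 * w ≡ e → e < 0ℤ → 0ℤ < - w
    half-neg {w} refl e<0 = ℤP.neg-mono-< (ℤP.*-cancelˡ-<-nonNeg {w} {0ℤ} (+ 2) e<0)

  PosCoords-· : ∀ z w → PosCoords z → PosCoords w → PosCoords (z · w)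
  PosCoords-· z w (0<trz , 0<imz) (0<trw , 0<imw) =
    half-pos (tr-· 4c≡Δ²-Δ z w) (ℤP.+-mono-< (*-pos 0<trz 0<trw) (*-pos 0<Δ (*-pos 0<imz 0<imw))) ,
    half-pos (im-· z w) (ℤP.+-mono-< (*-pos 0<trz 0<imw) (*-pos 0<trw 0<imz))

  PosCoords-^ : ∀ z → PosCoords z → ∀ n → PosCoords (z ^ suc n)
  PosCoords-^ z pz zero = subst PosCoords (sym (·-identityʳ z)) pz
  PosCoords-^ z pz (suc n) = PosCoords-· z (z ^ suc n) pz (PosCoords-^ z pz n)

  tr<tr· : ∀ z w → IsSign (N z) → PosCoords z → PosCoords w → tr z < tr (z · w)
  tr<tr· z w ±1 (0<trz , 0<imz) (0<trw , 0<imw) =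
    2A′≡Aa+ΔBb⇒A<A′ 0<trz 0<imz 0<trw 0<imw (pell-tr<Δim {tr z} {im z} {N z} ±1 (pellEq z) 0<imz) (tr-· 4c≡Δ²-Δ z w)

  PosCoords-tr-injective : ∀ z w → IsSign (N z) → IsSign (N w) → PosCoords z → PosCoords w →
                           tr z ≡ tr w → z ≡ w
  PosCoords-tr-injective z w ±1z ±1w pz pw trz≡trw with ℤP.<-cmp (im z) (im w)
  ... | tri≈ _ imz≡imw _ = tr-im-injective z w trz≡trw imz≡imw
  ... | tri< imz<imw _ _ = ⊥-elim (ℤP.<-irrefl trz≡trw (im<⇒tr< z w ±1z ±1w (proj₂ pz) (proj₁ pw) imz<imw))
  ... | tri> _ _ imw<imz = ⊥-elim (ℤP.<-irrefl (sym trz≡trw) (im<⇒tr< w z ±1w ±1z (proj₂ pw) (proj₁ pz) imw<imz))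

  -- z / u = N u · z · conj u, whose coordinates are positive when 1 < u < z.
  ÷-PosCoords : ∀ z u → IsSign (N z) → IsSign (N u) → PosCoords z → PosCoords u → tr u < tr z →
                Σ Elt λ w → IsSign (N w) × PosCoords w × z ≡ w · u
  ÷-PosCoords z u ±1z ±1u (0<A , 0<B) (0<a , 0<b) a<A = by-norm ±1u
    where
    w₀ = z · conj u
    ±1w₀ : IsSign (N w₀)
    ±1w₀ = subst IsSign (sym (trans (norm-· z (conj u)) (cong (N z *_) (norm-conj u)))) (sign-* ±1z ±1u)
    pell-u : ∀ {s} → N u ≡ s → PellEq (tr u) (im u) s
    pell-u Nu≡s = subst (PellEq (tr u) (im u)) Nu≡s (pellEq u)
    by-norm : IsSign (N u) → Σ Elt λ w → IsSign (N w) × PosCoords w × z ≡ w · u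
    by-norm (inj₁ Nu≡1) =
      w₀ , ±1w₀ , (half-pos (tr-·conj 4c≡Δ²-Δ z u) (i<j⇒0<j-i ΔbB<aA) , half-pos (im-·conj z u) (i<j⇒0<j-i Ab<aB)) ,
      sym (trans (·conj·≡·[N] z u) (trans (cong (λ n → z · [ n ]) Nu≡1) (·-identityʳ z)))
      where
      ineqs = pell-quotient-norm+ {tr u} {im u} {tr z} {im z} ±1z (pell-u Nu≡1) (pellEq z) 0<a 0<b 0<A 0<B a<A
      ΔbB<aA = proj₁ ineqs
      Ab<aB = proj₂ ineqs
    by-norm (inj₂ Nu≡-1) =
      negate w₀ , subst IsSign (sym (norm-negate w₀)) ±1w₀ ,
      (subst (0ℤ <_) (sym (tr-negate w₀)) (half-neg (tr-·conj 4c≡Δ²-Δ z u) (i<j⇒i-j<0 aA<ΔbB)) ,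
       half-neg (im-·conj z u) (i<j⇒i-j<0 aB<Ab)) ,
      sym (trans (negate-·ˡ w₀ u) (trans (cong negate (trans (·conj·≡·[N] z u) (trans (cong (λ n → z · [ n ]) Nu≡-1) (·-negate𝟙 z))))
                                          (negate-involutive z)))
      where
      ineqs = pell-quotient-norm- {tr u} {im u} {tr z} {im z} ±1z (pell-u Nu≡-1) (pellEq z) 0<a 0<b 0<A 0<B a<A
      aA<ΔbB = proj₁ ineqs
      aB<Ab = proj₂ ineqs


module FundamentalUnit (Δ : ℕ) (4c≡Δ²-Δ : + 4 * cω Δ ≡ + Δ * + Δ - + Δ) (0≤Δ-5 : 0ℤ ≤ + Δ - + 5)
                       (u : Elt) (fund : IsFundUnit Δ u) where

  open QuadraticRing Δ
  open Pell Δ 0≤Δ-5 hiding (d)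
  open UnitOrder Δ 4c≡Δ²-Δ 0≤Δ-5

  ±1u : IsSign (N u)
  ±1u = let (_ , v , _ , uv≡𝟙) = proj₁ fund in ·≡𝟙⇒sign u v uv≡𝟙

  pu : PosCoords u
  pu = 1≺⇒PosCoords u ±1u (proj₁ (proj₂ fund))

  u-minimal : ∀ z → IsSign (N z) → PosCoords z → tr u ≤ tr z
  u-minimal z ±1 pz = ≼⇒tr≤ u z ±1u ±1 pu pz (proj₂ (proj₂ fund) z (sign⇒Unit1 z ±1) (PosCoords⇒1≺ z pz))

  -- Induction on a bound n for tr z: dividing by u lowers the trace.
  descent-bounded : ∀ n z → IsSign (N z) → PosCoords z → tr z < + n → Σ ℕ λ k → z ≡ u ^ suc k
  descent-bounded zero z ±1 (0<tr , _) tr<0 = ⊥-elim (ℤP.<-asym 0<tr tr<0)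
  descent-bounded (suc n) z ±1 pz tr<1+n with ℤP.<-cmp (tr u) (tr z)
  ... | tri> _ _ trz<tru = ⊥-elim (ℤP.<⇒≱ trz<tru (u-minimal z ±1 pz))
  ... | tri≈ _ tru≡trz _ = 0 , trans (PosCoords-tr-injective z u ±1 ±1u pz pu (sym tru≡trz)) (sym (·-identityʳ u))
  ... | tri< tru<trz _ _ = let (w , ±1w , pw , z≡wu) = ÷-PosCoords z u ±1 ±1u pz pu tru<trz
                               trw<trz = subst (tr w <_) (cong tr (sym z≡wu)) (tr<tr· w u ±1w pw pu)
                               (k , w≡u^k) = descent-bounded n w ±1w pw (ℤP.<-≤-trans trw<trz (ℤP.i<j⇒i≤pred[j] tr<1+n))
                           in suc k , trans z≡wu (trans (cong (_· u) w≡u^k) (·-comm (u ^ suc k) u))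

  descent : ∀ z → IsSign (N z) → PosCoords z → Σ ℕ λ k → z ≡ u ^ suc k
  descent z ±1 pz = descent-bounded (suc ℤ.∣ tr z ∣) z ±1 pz tr<1+∣tr∣
    where
    tr<1+∣tr∣ : tr z < + suc ℤ.∣ tr z ∣
    tr<1+∣tr∣ = subst (λ t → tr z < 1ℤ + t) (sym (ℤP.0≤i⇒+∣i∣≡i (ℤP.<⇒≤ (proj₁ pz))))
                  (ℤP.suc[i]≤j⇒i<j ℤP.≤-refl)

  IsSignedPower : Elt → Set
  IsSignedPower z = Σ ℕ λ k → Σ Elt λ s → IsPM1 s × (z ≡ s · u ^ k ⊎ z · u ^ k ≡ s)

  signedPower-negate : ∀ z → IsSignedPower (negate z) → IsSignedPower z
  signedPower-negate z (k , s , pm , inj₁ -z≡su^k) = k , negate s , PM1-negate pm ,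
    inj₁ (trans (sym (negate-involutive z)) (trans (cong negate -z≡su^k) (sym (negate-·ˡ s (u ^ k)))))
  signedPower-negate z (k , s , pm , inj₂ -zu^k≡s) = k , negate s , PM1-negate pm ,
    inj₂ (trans (sym (negate-involutive (z · u ^ k))) (cong negate (trans (sym (negate-·ˡ z (u ^ k))) -zu^k≡s)))

  0<im⇒signedPower : ∀ z → IsSign (N z) → 0ℤ < im z → IsSignedPower z
  0<im⇒signedPower z ±1 0<im with ℤP.<-cmp 0ℤ (tr z)
  ... | tri< 0<tr _ _ = let (k , z≡u^k) = descent z ±1 (0<tr , 0<im) in
                        suc k , 𝟙 , inj₁ refl , inj₁ (trans z≡u^k (sym (·-identityˡ (u ^ suc k))))
  ... | tri≈ _ 0≡tr _ = ⊥-elim (pell-tr≢0 (im z) (N z) ±1 (subst (λ t → PellEq t (im z) (N z)) (sym 0≡tr) (pellEq z)) 0<im)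
  ... | tri> _ _ tr<0 = suc k , negate [ N z ] , PM1-negate (sign⇒PM1 ±1) , inj₂ zu^k≡-Nz
    where
    -- v = -z̄ is a unit above 1, so z · v = -N z.
    v = conj (negate z)
    Nv≡Nz : N v ≡ N z
    Nv≡Nz = trans (norm-conj (negate z)) (norm-negate z)
    pv : PosCoords v
    pv = subst (0ℤ <_) (sym (trans (tr-conj (negate z)) (tr-negate z))) (ℤP.neg-mono-< tr<0) ,
         subst (0ℤ <_) (sym (ℤP.neg-involutive (im z))) 0<im
    descent-v = descent v (subst IsSign (sym Nv≡Nz) ±1) pv
    k = proj₁ descent-v
    zu^k≡-Nz : z · u ^ suc k ≡ negate [ N z ]
    zu^k≡-Nz = begin
      z · u ^ suc k                    ≡⟨ cong (z ·_) (sym (proj₂ descent-v)) ⟩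
      z · conj (negate z)              ≡⟨ cong (_· conj (negate z)) (sym (negate-involutive z)) ⟩
      negate (negate z) · v            ≡⟨ negate-·ˡ (negate z) v ⟩
      negate (negate z · v)            ≡⟨ cong negate (·-conj (negate z)) ⟩
      negate [ N (negate z) ]          ≡⟨ cong (λ n → negate [ n ]) (norm-negate z) ⟩
      negate [ N z ]                   ∎
      where open ≡-Reasoning

  unit⇒signedPower : ∀ z → IsSign (N z) → IsSignedPower z
  unit⇒signedPower z ±1 with ℤP.<-cmp 0ℤ (im z)
  ... | tri< 0<im _ _ = 0<im⇒signedPower z ±1 0<im
  ... | tri> _ _ im<0 = signedPower-negate z
                          (0<im⇒signedPower (negate z) (subst IsSign (sym (norm-negate z)) ±1) (ℤP.neg-mono-< im<0))
  ... | tri≈ _ 0≡im _ = 0 , z , ±𝟙 (pell-im≡0 (tr z) (N z) ±1 (subst (λ t → PellEq (tr z) t (N z)) (sym 0≡im) (pellEq z))) ,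
                        inj₁ (sym (·-identityʳ z))
    where
    ±𝟙 : tr z ≡ + 2 ⊎ tr z ≡ - + 2 → IsPM1 z
    ±𝟙 (inj₁ tr≡2) = inj₁ (tr-im-injective z 𝟙 (trans tr≡2 (sym tr-𝟙)) (sym 0≡im))
    ±𝟙 (inj₂ tr≡-2) =
      inj₂ (tr-im-injective z (negate 𝟙) (trans tr≡-2 (sym (trans (tr-negate 𝟙) (cong -_ tr-𝟙)))) (sym 0≡im))

  tr-^-increasing : ∀ n → tr (u ^ suc n) < tr (u ^ suc (suc n))
  tr-^-increasing n = subst (λ w → tr (u ^ suc n) < tr w) (·-comm (u ^ suc n) u)
                        (tr<tr· (u ^ suc n) u (sign-norm-^ u ±1u (suc n)) (PosCoords-^ u pu n) pu)

  ε≡u² : ∀ {ε} → IsEps Δ ε → N u ≡ -1ℤ → ε ≡ u ^ 2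
  ε≡u² {ε} (_ , Nε≡1 , 𝟙≺ε , ε-minimal) Nu≡-1 = from-descent (descent ε (inj₁ Nε≡1) pε)
    where
    pε = 1≺⇒PosCoords ε (inj₁ Nε≡1) 𝟙≺ε
    Nu²≡1 : N (u ^ 2) ≡ 1ℤ
    Nu²≡1 = trans (norm-^ u 2) (cong (ℤ._^ 2) Nu≡-1)
    pu² = PosCoords-^ u pu 1
    trε≤tru² : tr ε ≤ tr (u ^ 2)
    trε≤tru² = ≼⇒tr≤ ε (u ^ 2) (inj₁ Nε≡1) (inj₁ Nu²≡1) pε pu²
                 (ε-minimal (u ^ 2) (sign⇒Unit1 (u ^ 2) (inj₁ Nu²≡1)) Nu²≡1 (PosCoords⇒1≺ (u ^ 2) pu²))
    tru²<tru^[3+_] : ∀ k → tr (u ^ 2) < tr (u ^ suc (suc (suc k)))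
    tru²<tru^[3+ zero ] = tr-^-increasing 1
    tru²<tru^[3+ suc k ] = ℤP.<-trans tru²<tru^[3+ k ] (tr-^-increasing (suc (suc k)))
    from-descent : Σ ℕ (λ k → ε ≡ u ^ suc k) → ε ≡ u ^ 2
    from-descent (1 , ε≡u²) = ε≡u²
    from-descent (0 , ε≡u) =
      ⊥-elim (1≢-1 (trans (sym Nε≡1) (trans (cong N ε≡u) (trans (norm-^ u 1) (cong (ℤ._^ 1) Nu≡-1)))))
      where
      1≢-1 : 1ℤ ≢ -1ℤ
      1≢-1 ()
    from-descent (suc (suc k) , ε≡u^[3+k]) =
      ⊥-elim (ℤP.<⇒≱ tru²<tru^[3+ k ] (subst (λ w → tr w ≤ tr (u ^ 2)) ε≡u^[3+k] trε≤tru²))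

  signedPower-norm : ∀ v k s → IsPM1 s → (v ≡ s · u ^ k ⊎ v · u ^ k ≡ s) → N v ≡ -1ℤ → N u ℤ.^ k ≡ -1ℤ
  signedPower-norm v k s pm (inj₁ v≡su^k) Nv≡-1 =
    trans (sym (trans (cong N v≡su^k) (trans (norm-· s (u ^ k)) (trans (cong (_* N (u ^ k)) (PM1-norm pm))
      (trans (ℤP.*-identityˡ _) (norm-^ u k)))))) Nv≡-1
  signedPower-norm v k s pm (inj₂ vu^k≡s) Nv≡-1 =
    trans (sym (ℤP.neg-involutive _)) (cong -_ (trans (sym (ℤP.-1*i≡-i _)) -Nu^k≡1))
    where
    -Nu^k≡1 : -1ℤ * N u ℤ.^ k ≡ 1ℤ
    -Nu^k≡1 = trans (cong₂ _*_ (sym Nv≡-1) (sym (norm-^ u k)))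
                (trans (sym (norm-· v (u ^ k))) (trans (cong N vu^k≡s) (PM1-norm pm)))

  module _ (f : ℕ) where

    InOrder-^-+ : ∀ {m n} → InOrder Δ f (u ^ m) → InOrder Δ f (u ^ n) → InOrder Δ f (u ^ (m ℕ.+ n))
    InOrder-^-+ {m} {n} u^m∈O u^n∈O = subst (InOrder Δ f) (sym (^-+ u m n)) (InOrder-· f {u ^ m} {u ^ n} u^m∈O u^n∈O)

    InOrder-^-∸ : ∀ {m n} → InOrder Δ f (u ^ (m ℕ.+ n)) → InOrder Δ f (u ^ n) → InOrder Δ f (u ^ m)
    InOrder-^-∸ {m} {n} u^[m+n]∈O u^n∈O =
      subst (InOrder Δ f) (sym (·≡⇒≡·inverse (u ^ m) (u ^ n) (u ^ (m ℕ.+ n)) (sign-norm-^ u ±1u n) (sym (^-+ u m n))))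
        (InOrder-· f {u ^ (m ℕ.+ n)} {inverse (u ^ n)} u^[m+n]∈O (InOrder-inverse f {u ^ n} u^n∈O))

    signedPower-InOrder : ∀ v k s → IsSign (N v) → InOrder Δ f v → IsPM1 s → (v ≡ s · u ^ k ⊎ v · u ^ k ≡ s) →
                          InOrder Δ f (u ^ k)
    signedPower-InOrder v k s ±1 v∈O pm (inj₁ v≡su^k) = subst (InOrder Δ f) sv≡u^k (InOrder-· f {s} {v} (InOrder-PM1 f pm) v∈O)
      where
      sv≡u^k : s · v ≡ u ^ k
      sv≡u^k = begin
        s · v             ≡⟨ cong (s ·_) v≡su^k ⟩
        s · (s · u ^ k)   ≡⟨ sym (·-assoc s s (u ^ k)) ⟩
        s · s · u ^ k     ≡⟨ cong (_· u ^ k) (PM1-square pm) ⟩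
        𝟙 · u ^ k         ≡⟨ ·-identityˡ (u ^ k) ⟩
        u ^ k             ∎
        where open ≡-Reasoning
    signedPower-InOrder v k s ±1 v∈O pm (inj₂ vu^k≡s) =
      subst (InOrder Δ f) v⁻¹s≡u^k (InOrder-· f {inverse v} {s} (InOrder-inverse f {v} v∈O) (InOrder-PM1 f pm))
      where
      v⁻¹s≡u^k : inverse v · s ≡ u ^ k
      v⁻¹s≡u^k = begin
        inverse v · s               ≡⟨ cong (inverse v ·_) (sym vu^k≡s) ⟩
        inverse v · (v · u ^ k)     ≡⟨ sym (·-assoc (inverse v) v (u ^ k)) ⟩
        inverse v · v · u ^ k       ≡⟨ cong (_· u ^ k) (trans (·-comm (inverse v) v) (·-inverse v ±1)) ⟩
        𝟙 · u ^ k                   ≡⟨ ·-identityˡ (u ^ k) ⟩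
        u ^ k                       ∎
        where open ≡-Reasoning


module NormMinusOne (Δ : ℕ) (disc : RealQuadDisc Δ) (u ε : Elt) (fund : IsFundUnit Δ u) (eps : IsEps Δ ε)
                    (fF dF : ℕ → ℤ) (fSeq : IsFSeq Δ ε fF) (dSeq : IsDSeq Δ ε dF)
                    (f jm : ℕ) (jmin : IsJMin fF f jm) where

  0≤Δ-5 : 0ℤ ≤ + Δ - + 5
  0≤Δ-5 = ℤP.i≤j⇒0≤j-i (+≤+ (RealQuadDisc⇒5≤Δ disc))

  open QuadraticRing Δ
  open UnitOrder Δ (4cω≡Δ²-Δ disc) 0≤Δ-5
  open FundamentalUnit Δ (4cω≡Δ²-Δ disc) 0≤Δ-5 u fund
  open ExponentSet (λ k → InOrder Δ f (u ^ k)) (λ {m} {n} → InOrder-^-+ f {m} {n}) (λ {m} {n} → InOrder-^-∸ f {m} {n})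

  instance
    jm≢0 : ℕ.NonZero jm
    jm≢0 = ℕ.>-nonZero (proj₁ jmin)
    Δ≢0 : ℕ.NonZero Δ
    Δ≢0 = ℕ.>-nonZero (ℕP.<-≤-trans (ℕ.s≤s ℕ.z≤n) (RealQuadDisc⇒5≤Δ disc))

  NormMinusOneUnit : Set
  NormMinusOneUnit = Σ Elt λ v → Unit Δ f v × N v ≡ -1ℤ

  Conditions : Set
  Conditions = IsSquare (dF 1 - + 3) × Odd jm × (∃[ t ] ((+ t * + t) * + Δ ≡ dF jm + 1ℤ × f ℕD.∣ t))

  Nε^j≡1 : ∀ j → N (ε ^ j) ≡ 1ℤ
  Nε^j≡1 j = trans (norm-^ ε j) (trans (cong (ℤ._^ j) (proj₁ (proj₂ eps))) (ℤP.^-zeroˡ j))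

  d-1≡tr : ∀ j → 1 ℕ.≤ j → dF j - 1ℤ ≡ tr (ε ^ j)
  d-1≡tr j 1≤j = IsDSeq⇒tr {ε} {dF} dSeq j 1≤j (Nε^j≡1 j)

  d+1≡tr+2 : ∀ j → 1 ℕ.≤ j → dF j + 1ℤ ≡ tr (ε ^ j) + + 2
  d+1≡tr+2 j 1≤j = ring-mod (d-1≡tr j 1≤j) (expand (dF j) (tr (ε ^ j)))
    where
    expand : ∀ D T → D + 1ℤ ≡ (T + + 2) + ((D - 1ℤ) - T)
    expand = solve-∀

  norm−1-unit⇒ : NormMinusOneUnit → N u ≡ -1ℤ × Σ ℕ λ k → Odd k × InOrder Δ f (u ^ k)
  norm−1-unit⇒ (v , (v∈O , w , _ , vw≡𝟙) , Nv≡-1) =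
    let ±1v = ·≡𝟙⇒sign v w vw≡𝟙
        (k , s , pm , v≡±u^±k) = unit⇒signedPower v ±1v
        (Nu≡-1 , odd-k) = sign^n≡-1 k ±1u (signedPower-norm v k s pm v≡±u^±k Nv≡-1)
    in Nu≡-1 , k , odd-k , signedPower-InOrder f v k s ±1v v∈O pm v≡±u^±k

  norm−1-unit⇐ : ∀ t → (+ t * + t) * + Δ ≡ dF jm + 1ℤ → f ℕD.∣ t → NormMinusOneUnit
  norm−1-unit⇐ zero 0≡d+1 _ = ⊥-elim (ℤP.<-irrefl (trans 0≡d+1 (d+1≡tr+2 jm (proj₁ jmin))) 0<trE+2)
    where
    pε : PosCoords ε
    pε = 1≺⇒PosCoords ε (inj₁ (proj₁ (proj₂ eps))) (proj₁ (proj₂ (proj₂ eps)))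
    pE : PosCoords (ε ^ jm)
    pE = subst (λ n → PosCoords (ε ^ n)) (ℕP.suc-pred jm) (PosCoords-^ ε pε (ℕ.pred jm))
    0<trE+2 : 0ℤ < tr (ε ^ jm) + + 2
    0<trE+2 = ℤP.+-mono-<-≤ (proj₁ pE) (0≤+ 2)
  norm−1-unit⇐ t@(suc _) t²Δ≡d+1 f∣t =
    let (x , Nw≡-1) = norm-1⇒norm−1 (4cω≡Δ²-Δ disc) (ε ^ jm) t (Nε^j≡1 jm)
                                    (trans t²Δ≡d+1 (d+1≡tr+2 jm (proj₁ jmin)))
    in (x , + t) , sign⇒Unit f {x , + t} f∣t (inj₂ Nw≡-1) , Nw≡-1

  module _ (Nu≡-1 : N u ≡ -1ℤ) where

    ε^j≡u^[j*2] : ∀ j → ε ^ j ≡ u ^ (j ℕ.* 2)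
    ε^j≡u^[j*2] j = trans (cong (_^ j) (ε≡u² eps Nu≡-1)) (sym (^-* u j 2))

    f_j≡im-u^[j*2] : ∀ j → 1 ℕ.≤ j → fF j ≡ im (u ^ (j ℕ.* 2))
    f_j≡im-u^[j*2] j 1≤j = trans (IsFSeq⇒im {ε} {fF} fSeq j 1≤j (Nε^j≡1 j)) (cong im (ε^j≡u^[j*2] j))

    u^[jm*2]∈O : InOrder Δ f (u ^ (jm ℕ.* 2))
    u^[jm*2]∈O = subst (+ f ℤD.∣_) (f_j≡im-u^[j*2] jm (proj₁ jmin)) (proj₁ (proj₂ jmin))

    jm-minimal : ∀ j → 1 ℕ.≤ j → InOrder Δ f (u ^ (j ℕ.* 2)) → jm ℕ.≤ j
    jm-minimal j 1≤j u^[j*2]∈O = proj₂ (proj₂ jmin) j 1≤j (subst (+ f ℤD.∣_) (sym (f_j≡im-u^[j*2] j 1≤j)) u^[j*2]∈O)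

    d₁-3≡tr² : dF 1 - + 3 ≡ tr u * tr u
    d₁-3≡tr² = ring-mod d₁-1≡tr²+2 (expand (dF 1) (tr u))
      where
      d₁-1≡tr²+2 : dF 1 - 1ℤ ≡ tr u * tr u + + 2
      d₁-1≡tr²+2 = trans (d-1≡tr 1 (ℕ.s≤s ℕ.z≤n))
                     (trans (cong tr (trans (ε^j≡u^[j*2] 1) (cong (u ·_) (·-identityʳ u))))
                            (norm−1⇒tr-square (4cω≡Δ²-Δ disc) u Nu≡-1))
      expand : ∀ D A → D - + 3 ≡ A * A + ((D - 1ℤ) - (A * A + + 2))
      expand = solve-∀

    d+1≡im²Δ : ∀ j → Odd j → dF j + 1ℤ ≡ im (u ^ j) * im (u ^ j) * + Δ
    d+1≡im²Δ j odd-j@(k , refl) = begin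
      dF j + 1ℤ                          ≡⟨ d+1≡tr+2 j (ℕ.s≤s ℕ.z≤n) ⟩
      tr (ε ^ j) + + 2                    ≡⟨ cong (λ z → tr z + + 2) ε^j≡u^j·u^j ⟩
      tr (u ^ j · u ^ j) + + 2            ≡⟨ sym (norm−1⇒im-square (4cω≡Δ²-Δ disc) (u ^ j) Nu^j≡-1) ⟩
      im (u ^ j) * im (u ^ j) * + Δ       ∎
      where
      open ≡-Reasoning
      ε^j≡u^j·u^j : ε ^ j ≡ u ^ j · u ^ j
      ε^j≡u^j·u^j = trans (ε^j≡u^[j*2] j) (trans (cong (u ^_) (ℕP.*-comm j 2)) (^-double u j))
      Nu^j≡-1 : N (u ^ j) ≡ -1ℤ
      Nu^j≡-1 = trans (norm-^ u j) (trans (cong (ℤ._^ j) Nu≡-1) (-1^odd odd-j))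

    module _ (u^jm∈O : InOrder Δ f (u ^ jm)) where

      unit⇔±u^jm : ∀ v → Unit Δ f v ⇔ PlusMinusPow Δ u jm v
      unit⇔±u^jm v = mk⇔ to from
        where
        to : Unit Δ f v → PlusMinusPow Δ u jm v
        to (v∈O , w , _ , vw≡𝟙) = to-multiple (unit⇒signedPower v ±1)
          where
          ±1 = ·≡𝟙⇒sign v w vw≡𝟙
          to-multiple : IsSignedPower v → PlusMinusPow Δ u jm v
          to-multiple (k , s , pm , v≡±u^±k) =
            ℕD._∣_.quotient jm∣k , s , pm ,
            subst (λ n → v ≡ s · u ^ n ⊎ v · u ^ n ≡ s) (ℕD._∣_.equality jm∣k) v≡±u^±k
            where
            jm∣k = j₀∣ u^[jm*2]∈O jm-minimal {k} (signedPower-InOrder f v k s ±1 v∈O pm v≡±u^±k)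
        from : PlusMinusPow Δ u jm v → Unit Δ f v
        from (q , s , pm , v≡±P) = sign⇒Unit f {v} (v∈O v≡±P) (±1v v≡±P)
          where
          P = u ^ (q ℕ.* jm)
          P∈O : InOrder Δ f P
          P∈O = P-* q u^jm∈O
          ±1P : IsSign (N P)
          ±1P = sign-norm-^ u ±1u (q ℕ.* jm)
          v∈O : v ≡ s · P ⊎ v · P ≡ s → InOrder Δ f v
          v∈O (inj₁ v≡sP) = subst (InOrder Δ f) (sym v≡sP) (InOrder-· f {s} {P} (InOrder-PM1 f pm) P∈O)
          v∈O (inj₂ vP≡s) = subst (InOrder Δ f) (sym (·≡⇒≡·inverse v P s ±1P vP≡s))
                              (InOrder-· f {s} {inverse P} (InOrder-PM1 f pm) (InOrder-inverse f {P} P∈O))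
          ±1v : v ≡ s · P ⊎ v · P ≡ s → IsSign (N v)
          ±1v (inj₁ v≡sP) = subst IsSign (sym (trans (cong N v≡sP) (norm-· s P))) (sign-* (inj₁ (PM1-norm pm)) ±1P)
          ±1v (inj₂ vP≡s) = *≡1⇒sign (trans (sym (norm-· v P)) (trans (cong N vP≡s) (PM1-norm pm)))

  norm−1-unit⇒jm-odd : NormMinusOneUnit → N u ≡ -1ℤ × Odd jm × InOrder Δ f (u ^ jm)
  norm−1-unit⇒jm-odd v =
    let (Nu≡-1 , k , odd-k , u^k∈O) = norm−1-unit⇒ v
    in Nu≡-1 , odd⇒j₀-odd (u^[jm*2]∈O Nu≡-1) (jm-minimal Nu≡-1) {k} u^k∈O odd-k

  norm−1-unit⇒conditions : NormMinusOneUnit → Conditions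
  norm−1-unit⇒conditions v =
    let (Nu≡-1 , odd-jm , u^jm∈O) = norm−1-unit⇒jm-odd v
        t²Δ≡d+1 = trans (cong (_* + Δ) (+∣i∣*+∣i∣≡i*i (im (u ^ jm)))) (sym (d+1≡im²Δ Nu≡-1 jm odd-jm))
    in (tr u , sym (d₁-3≡tr² Nu≡-1)) , odd-jm , ℤ.∣ im (u ^ jm) ∣ , t²Δ≡d+1 , u^jm∈O

  conditions⇒norm−1-unit : Conditions → NormMinusOneUnit
  conditions⇒norm−1-unit (_ , _ , t , t²Δ≡d+1 , f∣t) = norm−1-unit⇐ t t²Δ≡d+1 f∣t

  units : NormMinusOneUnit → ∀ v → Unit Δ f v ⇔ PlusMinusPow Δ u jm v
  units v₀ = let (Nu≡-1 , _ , u^jm∈O) = norm−1-unit⇒jm-odd v₀ in unit⇔±u^jm Nu≡-1 u^jm∈O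

theorem4p15 : (Δ₀ : ℕ) → RealQuadDisc Δ₀ →
    (u ε : Elt) → IsFundUnit Δ₀ u → IsEps Δ₀ ε →
    (fF dF : ℕ → ℤ) → IsFSeq Δ₀ ε fF → IsDSeq Δ₀ ε dF →
    (f : ℕ) → 0 ℕ.< f →
    (jm : ℕ) → IsJMin fF f jm →
    ((Σ Elt (λ v → Unit Δ₀ f v × norm Δ₀ v ≡ -1ℤ))
      ⇔ (IsSquare (dF 1 - + 3) × Odd jm ×
         (∃[ t ] ((+ t * + t) * + Δ₀ ≡ dF jm + 1ℤ × f ℕD.∣ t))))
    × ((Σ Elt (λ v → Unit Δ₀ f v × norm Δ₀ v ≡ -1ℤ)) →
       ∀ v → Unit Δ₀ f v ⇔ PlusMinusPow Δ₀ u jm v)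
-- The argument never uses 0 < f.
theorem4p15 Δ₀ disc u ε fund eps fF dF fSeq dSeq f _ jm jmin =
  mk⇔ norm−1-unit⇒conditions conditions⇒norm−1-unit , units
  where open NormMinusOne Δ₀ disc u ε fund eps fF dF fSeq dSeq f jm jmin
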